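{- For any $m\in\mathbb{Z}_{>0}$, $$\Gamma(m)=\{\mu\in\Lambda(m):\exp(\mathcal{A},\mu)=(m,\ \mu_1+\mu_2)\}.$$
   Context: Let $p$ be a prime, $\mathbb{F}=\mathbb{F}_p$, $S=\mathbb{F}[x,y]$, $\mathrm{Der}_S=S\partial_x\oplus S\partial_y$. Let $\mathcal{A}=\{H_1,H_2,H_3\}$ with $H_1=\ker x$, $H_2=\ker y$, $H_3=\ker(x+y)$, $\alpha_1=x,\alpha_2=y,\alpha_3=x+y$. For $\mu=(\mu_1,\mu_2,\mu_3)\in\mathbb{Z}_{\ge0}^3$, $D(\mathcal{A},\mu)=\{\theta\in\mathrm{Der}_S:\theta(\alpha_i)\in\alpha_i^{\mu_i}S,\ i=1,2,3\}$; it is free of rank 2 with a basis of homogeneous derivations, and $\exp(\mathcal{A},\mu)$ denotes the pair of degrees of such a basis (unique up to order). Let $\Lambda(m)=\{\mu\in\mathbb{Z}_{\ge0}^3:\mu_3=m\}$. For $\mu\in\Lambda(m)$ let $\psi_\mu=\sum_{j=\mu_1}^{m}\binom{m}{j}x^jy^{m-j}\partial_x+\sum_{j=0}^{\mu_1-1}\binom{m}{j}x^jy^{m-j}\partial_y$ (binomial coefficients read in $\mathbb{F}_p$; empty sums are zero) and $\psi'_\mu=x^{\mu_1}y^{\mu_2}(\partial_y-\partial_x)$, and let $\Gamma(m)=\{\mu\in\Lambda(m):\{\psi_\mu,\psi'_\mu\}\text{ is a basis for }D(\mathcal{A},\mu)\}$. -}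

module Defs where

open import Data.Nat as ℕ using (ℕ; zero; suc; _∸_)
open import Data.Nat.Combinatorics using (_C_)
open import Data.Integer as ℤ using (ℤ; +_; 0ℤ; 1ℤ)
open import Data.Integer.Divisibility using () renaming (_∣_ to _∣ℤ_)
open import Data.List using (List; []; _∷_; map; upTo; foldr)
open import Data.Product using (_×_; _,_; proj₁; proj₂; ∃; ∃₂)
open import Relation.Binary.PropositionalEquality using (_≡_; _≢_)

-- A polynomial is represented by an integer coefficient table
--   [ c_0 , c_1 , ... ]  with  c_i = [ c_i0 , c_i1 , ... ],
-- meaning  Σ_i Σ_j c_ij x^i y^j .  Missing entries are 0.
-- Elements of F_p[x,y] = ℤ[x,y]/(p) are compared by coefficientwise
-- congruence mod p (relation _≈[_]_ below).

addZ : List ℤ → List ℤ → List ℤ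
addZ [] g = g
addZ (a ∷ f) [] = a ∷ f
addZ (a ∷ f) (b ∷ g) = (a ℤ.+ b) ∷ addZ f g

mulZ : List ℤ → List ℤ → List ℤ
mulZ [] g = []
mulZ (a ∷ f) g = addZ (map (a ℤ.*_) g) (0ℤ ∷ mulZ f g)

Poly : Set
Poly = List (List ℤ)

infixl 6 _+P_
infixl 7 _*P_

_+P_ : Poly → Poly → Poly
[] +P g = g
(a ∷ f) +P [] = a ∷ f
(a ∷ f) +P (b ∷ g) = addZ a b ∷ (f +P g)

_*P_ : Poly → Poly → Poly
[] *P g = []
(a ∷ f) *P g = map (mulZ a) g +P ([] ∷ (f *P g))

negP : Poly → Poly
negP = map (map (λ c → ℤ.- c))

constP : ℤ → Poly
constP c = (c ∷ []) ∷ []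

0P : Poly
0P = []

X : Poly
X = [] ∷ (1ℤ ∷ []) ∷ []

Y : Poly
Y = (0ℤ ∷ 1ℤ ∷ []) ∷ []

_^P_ : Poly → ℕ → Poly
f ^P zero = constP 1ℤ
f ^P suc n = f *P (f ^P n)

lookupD : {A : Set} → List A → A → ℕ → A
lookupD [] d _ = d
lookupD (a ∷ as) d zero = a
lookupD (a ∷ as) d (suc n) = lookupD as d n

coeff : Poly → ℕ → ℕ → ℤ
coeff f i j = lookupD (lookupD f [] i) 0ℤ j

_≈[_]_ : Poly → ℕ → Poly → Set
f ≈[ p ] g = ∀ i j → (+ p) ∣ℤ (coeff f i j ℤ.- coeff g i j)

Divides : ℕ → Poly → Poly → Set
Divides p a f = ∃ λ h → f ≈[ p ] (a *P h)

Homogeneous : ℕ → ℕ → Poly → Set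
Homogeneous p d f = ∀ i j → i ℕ.+ j ≢ d → (+ p) ∣ℤ coeff f i j

-- Derivations  θ = f ∂_x + g ∂_y  represented as (f , g).

Der : Set
Der = Poly × Poly

_≈D[_]_ : Der → ℕ → Der → Set
θ ≈D[ p ] η = (proj₁ θ ≈[ p ] proj₁ η) × (proj₂ θ ≈[ p ] proj₂ η)

_+D_ : Der → Der → Der
(f , g) +D (f' , g') = (f +P f') , (g +P g')

_·D_ : Poly → Der → Der
a ·D (f , g) = (a *P f) , (a *P g)

0D : Der
0D = 0P , 0P

θx θy θxy : Der → Poly
θx θ = proj₁ θ
θy θ = proj₂ θ
θxy θ = proj₁ θ +P proj₂ θ

Mult : Set
Mult = ℕ × ℕ × ℕ

μ₁ μ₂ μ₃ : Mult → ℕ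
μ₁ μ = proj₁ μ
μ₂ μ = proj₁ (proj₂ μ)
μ₃ μ = proj₂ (proj₂ μ)

-- θ ∈ D(A, μ) over F_p, with α₁ = x, α₂ = y, α₃ = x + y
InD : ℕ → Mult → Der → Set
InD p μ θ =
  Divides p (X ^P μ₁ μ) (θx θ) ×
  Divides p (Y ^P μ₂ μ) (θy θ) ×
  Divides p ((X +P Y) ^P μ₃ μ) (θxy θ)

IsBasis : ℕ → Mult → Der → Der → Set
IsBasis p μ θ₁ θ₂ =
  InD p μ θ₁ × InD p μ θ₂ ×
  (∀ θ → InD p μ θ → ∃₂ λ a b → θ ≈D[ p ] ((a ·D θ₁) +D (b ·D θ₂))) ×
  (∀ a b → ((a ·D θ₁) +D (b ·D θ₂)) ≈D[ p ] 0D → (a ≈[ p ] 0P) × (b ≈[ p ] 0P))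

HomogeneousDer : ℕ → ℕ → Der → Set
HomogeneousDer p d θ = Homogeneous p d (proj₁ θ) × Homogeneous p d (proj₂ θ)

-- exp(A, μ) = (d₁, d₂) (unordered): D(A, μ) has a basis of homogeneous
-- derivations of degrees d₁ and d₂.
ExpIs : ℕ → Mult → ℕ → ℕ → Set
ExpIs p μ d₁ d₂ = ∃₂ λ θ₁ θ₂ →
  IsBasis p μ θ₁ θ₂ × HomogeneousDer p d₁ θ₁ × HomogeneousDer p d₂ θ₂

InΛ : ℕ → Mult → Set
InΛ m μ = μ₃ μ ≡ m

sumP : List ℕ → (ℕ → Poly) → Poly
sumP js t = foldr (λ j acc → t j +P acc) 0P js

range : ℕ → ℕ → List ℕ
range a b = map (a ℕ.+_) (upTo (suc b ∸ a))

binomTerm : ℕ → ℕ → Poly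
binomTerm m j = constP (+ (m C j)) *P ((X ^P j) *P (Y ^P (m ∸ j)))

ψ : ℕ → Mult → Der
ψ m μ = sumP (range (μ₁ μ) m) (binomTerm m) , sumP (upTo (μ₁ μ)) (binomTerm m)

ψ′ : Mult → Der
ψ′ μ = negP mon , mon
  where mon = (X ^P μ₁ μ) *P (Y ^P μ₂ μ)

InΓ : ℕ → ℕ → Mult → Set
InΓ p m μ = InΛ m μ × IsBasis p μ (ψ m μ) (ψ′ μ)

module Submission where

-- Write μ = (a , b , m).  Always ψ′_μ ∈ D(A, μ), x^a divides ψ_μ(x), and
-- ψ_μ(x) + ψ_μ(y) = (x+y)^m; the only obstruction to y^b dividing ψ_μ(y) are the binomial
-- coefficients C(m, i) with i < a and m − i < b.  When p divides all of them, every θ ∈ D(A, μ)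
-- with θ(x+y) = (x+y)^m h is h ψ_μ + q ψ′_μ, because h ψ_μ(x) − θ(x) is divisible both by x^a
-- and (being θ(y) − h ψ_μ(y)) by y^b, hence by x^a y^b; independence holds since x, y and x + y
-- are non-zero-divisors.  As ψ_μ and ψ′_μ are homogeneous of degrees m and a + b, this gives the
-- exponents.  Conversely, let θ₁, θ₂ be a homogeneous basis of degrees m and a + b with
-- θₖ(x+y) = (x+y)^m hₖ.  The coefficient of x^i y^(m−i) in θₖ(x+y) is C(m, i) hₖ(0, 0), and it
-- vanishes when i < a and m − i < b; so if some hₖ(0, 0) ≠ 0, p divides those binomials.  If
-- both vanish then θ₁(x+y) = 0 by degree; for a + b > m this forces θ₁ = 0, and for a + b ≤ m
-- also θ₂(x+y) = 0, so the pair cannot span (x+y)^m x^a y^b ∂ₓ.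

open import Level using (0ℓ)
open import Algebra.Bundles using (CommutativeRing; AbelianGroup)
open import Data.Empty using (⊥; ⊥-elim)
open import Data.Integer as ℤ using (ℤ; +_; 0ℤ; 1ℤ)
import Data.Integer.Properties as ℤᵖ
open import Data.List using (List; []; _∷_; map; drop; upTo)
open import Data.List.Membership.Propositional using (_∈_)
open import Data.List.Membership.Propositional.Properties using (∈-map⁺; ∈-map⁻; ∈-upTo⁺; ∈-upTo⁻)
open import Data.List.Relation.Unary.Unique.Propositional using (Unique)
import Data.List.Relation.Unary.Unique.Propositional.Properties as Unique
open import Data.Nat as ℕ using (ℕ; zero; suc)
import Data.Nat.Properties as ℕᵖ
import Data.Nat.Divisibility as ℕ∣
open import Data.Nat.Primality using (Prime)
open import Data.Product using (_×_; _,_; proj₁; proj₂; ∃₂)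
open import Data.Sum using (_⊎_; inj₁; inj₂)
open import Function using (_∘_; _$_)
open import Relation.Nullary using (¬_; Dec; yes; no; contradiction)
open import Relation.Binary.PropositionalEquality as ≡ using (_≡_; _≢_)
import Relation.Binary.Reasoning.Setoid as SetoidReasoning
open import Defs using (lookupD; range)

module ℤ-mod (n : ℕ) where

  open import Data.Integer using (_+_; _-_; _*_; -_)
  open import Data.Integer.Divisibility using () renaming (_∣_ to _∣ᵤ_)
  open import Data.Integer.Divisibility.Signed
    using (_∣_; _∣?_; divides; ∣m∣n⇒∣m+n; ∣m⇒∣-m; ∣n⇒∣m*n; ∣m⇒∣m*n; ∣ᵤ⇒∣; ∣⇒∣ᵤ)
  open import Data.Integer.Tactic.RingSolver using (solve-∀)
  open import Data.Nat.Primality using (euclidsLemma; ¬prime[1])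
  import Relation.Nullary.Decidable as Dec
  open ≡ using (refl)

  infix 4 _≈_
  record _≈_ (x y : ℤ) : Set where
    constructor mk≈
    field n∣x-y : + n ∣ x - y
  open _≈_ public

  private
    n∣-subst : ∀ {x y} → x ≡ y → + n ∣ x → + n ∣ y
    n∣-subst = ≡.subst (+ n ∣_)

  ≈-reflexive : ∀ {x y} → x ≡ y → x ≈ y
  ≈-reflexive {x} refl = mk≈ (n∣-subst (≡.sym (ℤᵖ.+-inverseʳ x)) (divides 0ℤ refl))

  ≈-sym : ∀ {x y} → x ≈ y → y ≈ x
  ≈-sym {x} {y} (mk≈ n∣x-y) = mk≈ (n∣-subst (eq x y) (∣m⇒∣-m n∣x-y))
    where
    eq : ∀ x y → - (x - y) ≡ y - x
    eq = solve-∀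

  ≈-trans : ∀ {x y z} → x ≈ y → y ≈ z → x ≈ z
  ≈-trans {x} {y} {z} (mk≈ n∣x-y) (mk≈ n∣y-z) =
    mk≈ (n∣-subst (eq x y z) (∣m∣n⇒∣m+n n∣x-y n∣y-z))
    where
    eq : ∀ x y z → (x - y) + (y - z) ≡ x - z
    eq = solve-∀

  +-cong : ∀ {x x′ y y′} → x ≈ x′ → y ≈ y′ → x + y ≈ x′ + y′
  +-cong {x} {x′} {y} {y′} (mk≈ n∣x-x′) (mk≈ n∣y-y′) =
    mk≈ (n∣-subst (eq x x′ y y′) (∣m∣n⇒∣m+n n∣x-x′ n∣y-y′))
    where
    eq : ∀ x x′ y y′ → (x - x′) + (y - y′) ≡ (x + y) - (x′ + y′)
    eq = solve-∀

  *-cong : ∀ {x x′ y y′} → x ≈ x′ → y ≈ y′ → x * y ≈ x′ * y′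
  *-cong {x} {x′} {y} {y′} (mk≈ n∣x-x′) (mk≈ n∣y-y′) =
    mk≈ (n∣-subst (eq x x′ y y′) (∣m∣n⇒∣m+n (∣m⇒∣m*n y n∣x-x′) (∣n⇒∣m*n x′ n∣y-y′)))
    where
    eq : ∀ x x′ y y′ → (x - x′) * y + x′ * (y - y′) ≡ x * y - x′ * y′
    eq = solve-∀

  -‿cong : ∀ {x x′} → x ≈ x′ → - x ≈ - x′
  -‿cong {x} {x′} (mk≈ n∣x-x′) = mk≈ (n∣-subst (eq x x′) (∣m⇒∣-m n∣x-x′))
    where
    eq : ∀ x x′ → - (x - x′) ≡ (- x) - (- x′)
    eq = solve-∀

  commutativeRing : CommutativeRing 0ℓ 0ℓ
  commutativeRing = record
    { Carrier = ℤ ; _≈_ = _≈_ ; _+_ = _+_ ; _*_ = _*_ ; -_ = -_ ; 0# = 0ℤ ; 1# = 1ℤ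
    ; isCommutativeRing = record
      { isRing = record
        { +-isAbelianGroup = record
          { isGroup = record
            { isMonoid = record
              { isSemigroup = record
                { isMagma = record
                  { isEquivalence = record { refl = ≈-reflexive refl ; sym = ≈-sym ; trans = ≈-trans }
                  ; ∙-cong = +-cong }
                ; assoc = λ x y z → ≈-reflexive (ℤᵖ.+-assoc x y z) }
              ; identity = (λ x → ≈-reflexive (ℤᵖ.+-identityˡ x))
                         , (λ x → ≈-reflexive (ℤᵖ.+-identityʳ x)) }
            ; inverse = (λ x → ≈-reflexive (ℤᵖ.+-inverseˡ x))
                      , (λ x → ≈-reflexive (ℤᵖ.+-inverseʳ x))
            ; ⁻¹-cong = -‿cong }
          ; comm = λ x y → ≈-reflexive (ℤᵖ.+-comm x y) }
        ; *-cong = *-cong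
        ; *-assoc = λ x y z → ≈-reflexive (ℤᵖ.*-assoc x y z)
        ; *-identity = (λ x → ≈-reflexive (ℤᵖ.*-identityˡ x))
                     , (λ x → ≈-reflexive (ℤᵖ.*-identityʳ x))
        ; distrib = (λ x y z → ≈-reflexive (ℤᵖ.*-distribˡ-+ x y z))
                  , (λ x y z → ≈-reflexive (ℤᵖ.*-distribʳ-+ x y z)) }
      ; *-comm = λ x y → ≈-reflexive (ℤᵖ.*-comm x y) } }

  ≈0⇒∣ : ∀ {x} → x ≈ 0ℤ → + n ∣ᵤ x
  ≈0⇒∣ {x} (mk≈ n∣x-0) = ∣⇒∣ᵤ (n∣-subst (ℤᵖ.+-identityʳ x) n∣x-0)

  ∣⇒≈0 : ∀ {x} → + n ∣ᵤ x → x ≈ 0ℤ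
  ∣⇒≈0 {x} n∣x = mk≈ (n∣-subst (≡.sym (ℤᵖ.+-identityʳ x)) (∣ᵤ⇒∣ n∣x))

  ≈0? : ∀ x → Dec (x ≈ 0ℤ)
  ≈0? x = Dec.map′ mk≈ n∣x-y (+ n ∣? x - 0ℤ)

  k*x≈0⇒n∣k : Prime n → ∀ k {x} → ¬ x ≈ 0ℤ → + k * x ≈ 0ℤ → n ℕ∣.∣ k
  k*x≈0⇒n∣k n-prime k {x} x≉0 kx≈0
    with euclidsLemma k ℤ.∣ x ∣ n-prime (≡.subst (n ℕ∣.∣_) (ℤᵖ.abs-* (+ k) x) (≈0⇒∣ kx≈0))
  ... | inj₁ n∣k = n∣k
  ... | inj₂ n∣x = contradiction (∣⇒≈0 n∣x) x≉0

  prime⇒1≉0 : Prime n → ¬ 1ℤ ≈ 0ℤ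
  prime⇒1≉0 n-prime 1≈0 = ¬prime[1] (≡.subst Prime (ℕ∣.∣1⇒≡1 (≈0⇒∣ 1≈0)) n-prime)

module Polynomial (R : CommutativeRing 0ℓ 0ℓ) where

  import Algebra.Construct.Pointwise as Pointwise
  import Algebra.Morphism.GroupMonomorphism as GroupMonomorphism
  open import Algebra.Morphism.Structures using (IsGroupMonomorphism)
  open import Algebra.Properties.Ring (CommutativeRing.ring R) using (-0#≈0#)
  open CommutativeRing R renaming (Carrier to A) hiding (zero)
  private module ≈-Reasoning = SetoidReasoning setoid

  Poly : Set
  Poly = List A

  coeff : Poly → ℕ → A
  coeff f = lookupD f 0#

  infix 4 _≋_
  record _≋_ (f g : Poly) : Set where
    constructor mk≋
    field coeff-≈ : ∀ n → coeff f n ≈ coeff g n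
  open _≋_ public

  infixl 6 _⊕_
  infixl 7 _⊛_ _•_

  _⊕_ : Poly → Poly → Poly
  [] ⊕ g = g
  (a ∷ f) ⊕ [] = a ∷ f
  (a ∷ f) ⊕ (b ∷ g) = (a + b) ∷ (f ⊕ g)

  ⊝_ : Poly → Poly
  ⊝_ = map (-_)

  _•_ : A → Poly → Poly
  a • f = map (a *_) f

  _⊛_ : Poly → Poly → Poly
  [] ⊛ g = []
  (a ∷ f) ⊛ g = a • g ⊕ (0# ∷ f ⊛ g)

  one : Poly
  one = 1# ∷ []

  var : Poly
  var = 0# ∷ 1# ∷ []

  coeff-⊕ : ∀ f g n → coeff (f ⊕ g) n ≈ coeff f n + coeff g n
  coeff-⊕ [] g n = sym (+-identityˡ _)
  coeff-⊕ (a ∷ f) [] n = sym (+-identityʳ _)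
  coeff-⊕ (a ∷ f) (b ∷ g) zero = refl
  coeff-⊕ (a ∷ f) (b ∷ g) (suc n) = coeff-⊕ f g n

  coeff-⊝ : ∀ f n → coeff (⊝ f) n ≈ - coeff f n
  coeff-⊝ [] n = sym -0#≈0#
  coeff-⊝ (a ∷ f) zero = refl
  coeff-⊝ (a ∷ f) (suc n) = coeff-⊝ f n

  coeff-• : ∀ a f n → coeff (a • f) n ≈ a * coeff f n
  coeff-• a [] n = sym (zeroʳ a)
  coeff-• a (b ∷ f) zero = refl
  coeff-• a (b ∷ f) (suc n) = coeff-• a f n

  coeff-isGroupMonomorphism :
    IsGroupMonomorphism
      (record { _≈_ = _≋_ ; _∙_ = _⊕_ ; ε = [] ; _⁻¹ = ⊝_ })
      (record { _≈_ = λ u v → ∀ n → u n ≈ v n ; _∙_ = λ u v n → u n + v n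
              ; ε = λ _ → 0# ; _⁻¹ = λ u n → - u n })
      coeff
  coeff-isGroupMonomorphism = record
    { isGroupHomomorphism = record
      { isMonoidHomomorphism = record
        { isMagmaHomomorphism = record
          { isRelHomomorphism = record { cong = coeff-≈ }
          ; homo = coeff-⊕ }
        ; ε-homo = λ _ → refl }
      ; ⁻¹-homo = coeff-⊝ }
    ; injective = mk≋ }

  ⊕-abelianGroup : AbelianGroup 0ℓ 0ℓ
  ⊕-abelianGroup = record
    { isAbelianGroup = GroupMonomorphism.isAbelianGroup coeff-isGroupMonomorphism
        (Pointwise.isAbelianGroup ℕ +-isAbelianGroup) }

  private
    module ⊕ = AbelianGroup ⊕-abelianGroup
    module ≋-Reasoning = SetoidReasoning ⊕.setoid
  open ⊕ public using () renaming (refl to ≋-refl; sym to ≋-sym; trans to ≋-trans; reflexive to ≋-reflexive)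
  open import Algebra.Properties.CommutativeSemigroup ⊕.commutativeSemigroup using (interchange; x∙yz≈y∙xz)

  ∷-cong : ∀ {a b f g} → a ≈ b → f ≋ g → a ∷ f ≋ b ∷ g
  ∷-cong a≈b f≋g = mk≋ λ { zero → a≈b ; (suc n) → coeff-≈ f≋g n }

  ∷-injective : ∀ {a b f g} → a ∷ f ≋ b ∷ g → f ≋ g
  ∷-injective a∷f≋b∷g = mk≋ λ n → coeff-≈ a∷f≋b∷g (suc n)

  0∷-≋[] : ∀ {f} → f ≋ [] → 0# ∷ f ≋ []
  0∷-≋[] f≋[] = mk≋ λ { zero → refl ; (suc n) → coeff-≈ f≋[] n }

  •-cong : ∀ {a b f g} → a ≈ b → f ≋ g → a • f ≋ b • g
  •-cong {a} {b} {f} {g} a≈b f≋g = mk≋ λ n → begin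
    coeff (a • f) n  ≈⟨ coeff-• a f n ⟩
    a * coeff f n    ≈⟨ *-cong a≈b (coeff-≈ f≋g n) ⟩
    b * coeff g n    ≈⟨ coeff-• b g n ⟨
    coeff (b • g) n  ∎
    where open ≈-Reasoning

  •-distribˡ : ∀ a f g → a • (f ⊕ g) ≋ a • f ⊕ a • g
  •-distribˡ a f g = mk≋ λ n → begin
    coeff (a • (f ⊕ g)) n              ≈⟨ coeff-• a (f ⊕ g) n ⟩
    a * coeff (f ⊕ g) n                ≈⟨ *-congˡ (coeff-⊕ f g n) ⟩
    a * (coeff f n + coeff g n)        ≈⟨ distribˡ a _ _ ⟩
    a * coeff f n + a * coeff g n      ≈⟨ +-cong (coeff-• a f n) (coeff-• a g n) ⟨
    coeff (a • f) n + coeff (a • g) n  ≈⟨ coeff-⊕ (a • f) (a • g) n ⟨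
    coeff (a • f ⊕ a • g) n            ∎
    where open ≈-Reasoning

  •-distribʳ : ∀ a b f → (a + b) • f ≋ a • f ⊕ b • f
  •-distribʳ a b f = mk≋ λ n → begin
    coeff ((a + b) • f) n              ≈⟨ coeff-• (a + b) f n ⟩
    (a + b) * coeff f n                ≈⟨ distribʳ _ a b ⟩
    a * coeff f n + b * coeff f n      ≈⟨ +-cong (coeff-• a f n) (coeff-• b f n) ⟨
    coeff (a • f) n + coeff (b • f) n  ≈⟨ coeff-⊕ (a • f) (b • f) n ⟨
    coeff (a • f ⊕ b • f) n            ∎
    where open ≈-Reasoning

  •-assoc : ∀ a b f → a • (b • f) ≋ (a * b) • f
  •-assoc a b f = mk≋ λ n → begin
    coeff (a • (b • f)) n  ≈⟨ coeff-• a (b • f) n ⟩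
    a * coeff (b • f) n    ≈⟨ *-congˡ (coeff-• b f n) ⟩
    a * (b * coeff f n)    ≈⟨ *-assoc a b _ ⟨
    (a * b) * coeff f n    ≈⟨ coeff-• (a * b) f n ⟨
    coeff ((a * b) • f) n  ∎
    where open ≈-Reasoning

  •-zeroˡ : ∀ {a} f → a ≈ 0# → a • f ≋ []
  •-zeroˡ {a} f a≈0 = mk≋ λ n → begin
    coeff (a • f) n  ≈⟨ coeff-• a f n ⟩
    a * coeff f n    ≈⟨ *-congʳ a≈0 ⟩
    0# * coeff f n   ≈⟨ zeroˡ _ ⟩
    0#               ∎
    where open ≈-Reasoning

  •-identityˡ : ∀ f → 1# • f ≋ f
  •-identityˡ f = mk≋ λ n → trans (coeff-• 1# f n) (*-identityˡ _)

  ⊛-zeroˡ : ∀ {f} g → f ≋ [] → f ⊛ g ≋ []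
  ⊛-zeroˡ {[]} g _ = ≋-refl
  ⊛-zeroˡ {a ∷ f} g a∷f≋[] = ≋-trans
    (⊕.∙-cong (•-zeroˡ g (coeff-≈ a∷f≋[] 0))
              (∷-cong refl (⊛-zeroˡ {f} g (mk≋ λ n → coeff-≈ a∷f≋[] (suc n)))))
    (0∷-≋[] ≋-refl)

  ⊛-congˡ : ∀ {f f′} g → f ≋ f′ → f ⊛ g ≋ f′ ⊛ g
  ⊛-congˡ {[]} g f≋f′ = ≋-sym (⊛-zeroˡ g (≋-sym f≋f′))
  ⊛-congˡ {a ∷ f} {[]} g f≋f′ = ⊛-zeroˡ g f≋f′
  ⊛-congˡ {a ∷ f} {a′ ∷ f′} g f≋f′ =
    ⊕.∙-cong (•-cong (coeff-≈ f≋f′ 0) ≋-refl) (∷-cong refl (⊛-congˡ g (∷-injective f≋f′)))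

  ⊛-congʳ : ∀ f {g g′} → g ≋ g′ → f ⊛ g ≋ f ⊛ g′
  ⊛-congʳ [] g≋g′ = ≋-refl
  ⊛-congʳ (a ∷ f) g≋g′ = ⊕.∙-cong (•-cong refl g≋g′) (∷-cong refl (⊛-congʳ f g≋g′))

  ⊛-zeroʳ : ∀ f → f ⊛ [] ≋ []
  ⊛-zeroʳ [] = ≋-refl
  ⊛-zeroʳ (a ∷ f) = 0∷-≋[] (⊛-zeroʳ f)

  ⊛-distribʳ : ∀ f g h → (f ⊕ g) ⊛ h ≋ f ⊛ h ⊕ g ⊛ h
  ⊛-distribʳ [] g h = ≋-refl
  ⊛-distribʳ (a ∷ f) [] h = ≋-sym (⊕.identityʳ _)
  ⊛-distribʳ (a ∷ f) (b ∷ g) h = begin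
    (a + b) • h ⊕ (0# ∷ (f ⊕ g) ⊛ h)
      ≈⟨ ⊕.∙-cong (•-distribʳ a b h) (∷-cong (sym (+-identityʳ 0#)) (⊛-distribʳ f g h)) ⟩
    (a • h ⊕ b • h) ⊕ ((0# ∷ f ⊛ h) ⊕ (0# ∷ g ⊛ h))
      ≈⟨ interchange (a • h) (b • h) _ _ ⟩
    (a • h ⊕ (0# ∷ f ⊛ h)) ⊕ (b • h ⊕ (0# ∷ g ⊛ h))
      ∎
    where open ≋-Reasoning

  ⊛-∷ʳ : ∀ f b g → f ⊛ (b ∷ g) ≋ b • f ⊕ (0# ∷ f ⊛ g)
  ⊛-∷ʳ [] b g = ≋-sym (0∷-≋[] ≋-refl)
  ⊛-∷ʳ (a ∷ f) b g = ∷-cong (+-congʳ (*-comm a b)) (begin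
    a • g ⊕ f ⊛ (b ∷ g)             ≈⟨ ⊕.∙-congˡ (⊛-∷ʳ f b g) ⟩
    a • g ⊕ (b • f ⊕ (0# ∷ f ⊛ g))  ≈⟨ x∙yz≈y∙xz (a • g) (b • f) _ ⟩
    b • f ⊕ (a • g ⊕ (0# ∷ f ⊛ g))  ∎)
    where open ≋-Reasoning

  ⊛-comm : ∀ f g → f ⊛ g ≋ g ⊛ f
  ⊛-comm [] g = ≋-sym (⊛-zeroʳ g)
  ⊛-comm (a ∷ f) g = ≋-trans (⊕.∙-congˡ (∷-cong refl (⊛-comm f g))) (≋-sym (⊛-∷ʳ g a f))

  •-⊛ : ∀ a f g → a • (f ⊛ g) ≋ (a • f) ⊛ g
  •-⊛ a [] g = ≋-refl
  •-⊛ a (b ∷ f) g = ≋-trans (•-distribˡ a (b • g) _)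
    (⊕.∙-cong (•-assoc a b g) (∷-cong (zeroʳ a) (•-⊛ a f g)))

  0∷-⊛ : ∀ f g → (0# ∷ f) ⊛ g ≋ 0# ∷ f ⊛ g
  0∷-⊛ f g = ⊕.∙-congʳ (•-zeroˡ g refl)

  ⊛-assoc : ∀ f g h → (f ⊛ g) ⊛ h ≋ f ⊛ (g ⊛ h)
  ⊛-assoc [] g h = ≋-refl
  ⊛-assoc (a ∷ f) g h = ≋-trans (⊛-distribʳ (a • g) (0# ∷ f ⊛ g) h)
    (⊕.∙-cong (≋-sym (•-⊛ a g h)) (≋-trans (0∷-⊛ (f ⊛ g) h) (∷-cong refl (⊛-assoc f g h))))

  const-⊛ : ∀ a g → (a ∷ []) ⊛ g ≋ a • g
  const-⊛ a g = ≋-trans (⊕.∙-congˡ (0∷-≋[] ≋-refl)) (⊕.identityʳ (a • g))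

  ⊛-identityˡ : ∀ g → one ⊛ g ≋ g
  ⊛-identityˡ g = ≋-trans (const-⊛ 1# g) (•-identityˡ g)

  var-⊛ : ∀ g → var ⊛ g ≋ 0# ∷ g
  var-⊛ g = ⊕.∙-cong (•-zeroˡ g refl) (∷-cong refl (⊛-identityˡ g))

  commutativeRing : CommutativeRing 0ℓ 0ℓ
  commutativeRing = record
    { Carrier = Poly ; _≈_ = _≋_ ; _+_ = _⊕_ ; _*_ = _⊛_ ; -_ = ⊝_ ; 0# = [] ; 1# = one
    ; isCommutativeRing = record
      { isRing = record
        { +-isAbelianGroup = ⊕.isAbelianGroup
        ; *-cong = λ {f} {f′} {g} {g′} f≋f′ g≋g′ → ≋-trans (⊛-congˡ g f≋f′) (⊛-congʳ f′ g≋g′)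
        ; *-assoc = ⊛-assoc
        ; *-identity = ⊛-identityˡ , λ g → ≋-trans (⊛-comm g one) (⊛-identityˡ g)
        ; distrib = (λ f g h → ≋-trans (⊛-comm f (g ⊕ h))
                                 (≋-trans (⊛-distribʳ g h f) (⊕.∙-cong (⊛-comm g f) (⊛-comm h f))))
                  , (λ h f g → ⊛-distribʳ f g h) }
      ; *-comm = ⊛-comm } }

data Split (a : ℕ) : ℕ → Set where
  below : ∀ {i} → i ℕ.< a → Split a i
  above : ∀ k → Split a (a ℕ.+ k)

split : ∀ a i → Split a i
split a i with i ℕ.<? a
... | yes i<a = below i<a
... | no i≮a = ≡.subst (Split a) (ℕᵖ.m+[n∸m]≡n (ℕᵖ.≮⇒≥ i≮a)) (above (i ℕ.∸ a))

lookupD-drop : ∀ {A : Set} n (xs : List A) d k → lookupD (drop n xs) d k ≡ lookupD xs d (n ℕ.+ k)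
lookupD-drop zero xs d k = ≡.refl
lookupD-drop (suc n) [] d k = ≡.refl
lookupD-drop (suc n) (x ∷ xs) d k = lookupD-drop n xs d k

lookupD-map : ∀ {A B : Set} (h : A → B) xs d i → lookupD (map h xs) (h d) i ≡ h (lookupD xs d i)
lookupD-map h [] d i = ≡.refl
lookupD-map h (x ∷ xs) d zero = ≡.refl
lookupD-map h (x ∷ xs) d (suc i) = lookupD-map h xs d i

∈-range⁻ : ∀ {a m k} → k ∈ range a m → a ℕ.≤ k
∈-range⁻ {a} k∈range with ∈-map⁻ (a ℕ.+_) k∈range
... | i , _ , ≡.refl = ℕᵖ.m≤m+n a i

∈-range⁺ : ∀ {a m k} → a ℕ.≤ k → k ℕ.≤ m → k ∈ range a m
∈-range⁺ {a} {m} a≤k k≤m = ≡.subst (_∈ range a m) (ℕᵖ.m+[n∸m]≡n a≤k)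
  (∈-map⁺ (a ℕ.+_) (∈-upTo⁺ (ℕᵖ.∸-monoˡ-< (ℕ.s≤s k≤m) a≤k)))

range-unique : ∀ a m → Unique (range a m)
range-unique a m = Unique.map⁺ (ℕᵖ.+-cancelˡ-≡ a _ _) (Unique.upTo⁺ (suc m ℕ.∸ a))

module Bivariate (p : ℕ) where

  import Algebra.Morphism.RingMonomorphism as RingMonomorphism
  open import Algebra.Morphism.Structures using (IsRingMonomorphism)
  import Data.Integer.Divisibility.Signed as Signed
  open import Data.List.Properties using (map-cong; drop-[])
  import Data.List.Relation.Unary.All as All
  open import Data.List.Relation.Unary.AllPairs using (_∷_)
  open import Data.List.Relation.Unary.Any using (here; there)
  open import Data.Maybe using (nothing)
  open import Data.Nat using (_<_; _+_; _∸_; s≤s)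
  open import Data.Nat.Combinatorics using (_C_; nCk+nC[k+1]≡[n+1]C[k+1]; k>n⇒nCk≡0)
  open import Tactic.RingSolver using (solve-∀)
  open import Tactic.RingSolver.Core.AlmostCommutativeRing using (AlmostCommutativeRing; fromCommutativeRing)
  open import Defs
  open ℤ-mod p using (mk≈; n∣x-y) renaming (_≈_ to _≈ᶻ_)

  -- Defs lists the coefficients of x⁰, x¹, … of a polynomial, each a polynomial in y, and its
  -- operations agree with those of (𝔽ₚ[y])[x]; so the identity map is a ring monomorphism into it.
  module 𝔽ₚ[y] = Polynomial (ℤ-mod.commutativeRing p)
  module 𝔽ₚ[y][x] = Polynomial 𝔽ₚ[y].commutativeRing
  open 𝔽ₚ[y] using () renaming (_⊕_ to _⊕ʸ_; _⊛_ to _⊛ʸ_)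
  open 𝔽ₚ[y][x] using () renaming (_⊕_ to _⊕ˣ_; _⊛_ to _⊛ˣ_)

  addZ≡⊕ʸ : ∀ f g → addZ f g ≡ f ⊕ʸ g
  addZ≡⊕ʸ [] g = ≡.refl
  addZ≡⊕ʸ (a ∷ f) [] = ≡.refl
  addZ≡⊕ʸ (a ∷ f) (b ∷ g) = ≡.cong (_ ∷_) (addZ≡⊕ʸ f g)

  mulZ≡⊛ʸ : ∀ f g → mulZ f g ≡ f ⊛ʸ g
  mulZ≡⊛ʸ [] g = ≡.refl
  mulZ≡⊛ʸ (a ∷ f) g =
    ≡.trans (addZ≡⊕ʸ (map (a ℤ.*_) g) _) (≡.cong (λ h → _ ⊕ʸ (0ℤ ∷ h)) (mulZ≡⊛ʸ f g))

  +P≡⊕ˣ : ∀ f g → f +P g ≡ f ⊕ˣ g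
  +P≡⊕ˣ [] g = ≡.refl
  +P≡⊕ˣ (a ∷ f) [] = ≡.refl
  +P≡⊕ˣ (a ∷ f) (b ∷ g) = ≡.cong₂ _∷_ (addZ≡⊕ʸ a b) (+P≡⊕ˣ f g)

  *P≡⊛ˣ : ∀ f g → f *P g ≡ f ⊛ˣ g
  *P≡⊛ˣ [] g = ≡.refl
  *P≡⊛ˣ (a ∷ f) g = ≡.trans (+P≡⊕ˣ (map (mulZ a) g) _)
    (≡.cong₂ (λ u v → u ⊕ˣ ([] ∷ v)) (map-cong (mulZ≡⊛ʸ a) g) (*P≡⊛ˣ f g))

  infix 4 _≈_
  _≈_ : Poly → Poly → Set
  _≈_ = 𝔽ₚ[y][x]._≋_

  id-isRingMonomorphism :
    IsRingMonomorphism
      (record { _≈_ = _≈_ ; _+_ = _+P_ ; _*_ = _*P_ ; -_ = negP ; 0# = 0P ; 1# = constP 1ℤ })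
      (CommutativeRing.rawRing 𝔽ₚ[y][x].commutativeRing)
      (λ f → f)
  id-isRingMonomorphism = record
    { isRingHomomorphism = record
      { isSemiringHomomorphism = record
        { isNearSemiringHomomorphism = record
          { +-isMonoidHomomorphism = record
            { isMagmaHomomorphism = record
              { isRelHomomorphism = record { cong = λ f≈g → f≈g }
              ; homo = λ f g → 𝔽ₚ[y][x].≋-reflexive (+P≡⊕ˣ f g) }
            ; ε-homo = 𝔽ₚ[y][x].≋-refl }
          ; *-homo = λ f g → 𝔽ₚ[y][x].≋-reflexive (*P≡⊛ˣ f g) }
        ; 1#-homo = 𝔽ₚ[y][x].≋-refl }
      ; -‿homo = λ _ → 𝔽ₚ[y][x].≋-refl }
    ; injective = λ f≈g → f≈g }

  commutativeRing : CommutativeRing 0ℓ 0ℓ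
  commutativeRing = record
    { isCommutativeRing = RingMonomorphism.isCommutativeRing id-isRingMonomorphism
        (CommutativeRing.isCommutativeRing 𝔽ₚ[y][x].commutativeRing) }

  almostCommutativeRing : AlmostCommutativeRing 0ℓ 0ℓ
  almostCommutativeRing = fromCommutativeRing commutativeRing (λ _ → nothing)

  module P = CommutativeRing commutativeRing
  module Z = CommutativeRing (ℤ-mod.commutativeRing p)
  module ≈-Reasoning = SetoidReasoning P.setoid
  module ≈ᶻ-Reasoning = SetoidReasoning Z.setoid
  open import Algebra.Properties.AbelianGroup P.+-abelianGroup using (x∙y⁻¹≈ε⇒x≈y)
  open import Algebra.Properties.CommutativeSemigroup P.*-commutativeSemigroup using (x∙yz≈y∙xz)
  open import Algebra.Properties.Ring P.ring using (-‿distribʳ-*)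

  *P-congˡ : ∀ g {f f′} → f ≈ f′ → g *P f ≈ g *P f′
  *P-congˡ g = P.*-cong (P.refl {g})

  +P-congˡ : ∀ g {f f′} → f ≈ f′ → g +P f ≈ g +P f′
  +P-congˡ g = P.+-cong (P.refl {g})

  coeff-≈ : ∀ {f g} → f ≈ g → ∀ i j → coeff f i j ≈ᶻ coeff g i j
  coeff-≈ f≈g i j = 𝔽ₚ[y].coeff-≈ (𝔽ₚ[y][x].coeff-≈ f≈g i) j

  ≈[]⇒≈ : ∀ {f g} → f ≈[ p ] g → f ≈ g
  ≈[]⇒≈ f≈g = 𝔽ₚ[y][x].mk≋ λ i → 𝔽ₚ[y].mk≋ λ j → mk≈ (Signed.∣ᵤ⇒∣ (f≈g i j))

  ≈⇒≈[] : ∀ {f g} → f ≈ g → f ≈[ p ] g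
  ≈⇒≈[] f≈g i j = Signed.∣⇒∣ᵤ (n∣x-y (coeff-≈ f≈g i j))

  coeff-+P : ∀ f g i j → coeff (f +P g) i j ≈ᶻ coeff f i j ℤ.+ coeff g i j
  coeff-+P f g i j = Z.trans (coeff-≈ (𝔽ₚ[y][x].≋-reflexive (+P≡⊕ˣ f g)) i j)
    (Z.trans (𝔽ₚ[y].coeff-≈ (𝔽ₚ[y][x].coeff-⊕ f g i) j)
             (𝔽ₚ[y].coeff-⊕ (𝔽ₚ[y][x].coeff f i) (𝔽ₚ[y][x].coeff g i) j))

  coeff-negP : ∀ f i j → coeff (negP f) i j ≈ᶻ ℤ.- coeff f i j
  coeff-negP f i j =
    Z.trans (𝔽ₚ[y].coeff-≈ (𝔽ₚ[y][x].coeff-⊝ f i) j) (𝔽ₚ[y].coeff-⊝ (𝔽ₚ[y][x].coeff f i) j)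

  coeff-[r]*P : ∀ r g i j → coeff ((r ∷ []) *P g) i j ≈ᶻ 𝔽ₚ[y].coeff (r ⊛ʸ 𝔽ₚ[y][x].coeff g i) j
  coeff-[r]*P r g i j =
    Z.trans (coeff-≈ (P.trans (𝔽ₚ[y][x].≋-reflexive (*P≡⊛ˣ (r ∷ []) g)) (𝔽ₚ[y][x].const-⊛ r g)) i j)
            (𝔽ₚ[y].coeff-≈ (𝔽ₚ[y][x].coeff-• r g i) j)

  coeff-constP*P : ∀ c g i j → coeff (constP c *P g) i j ≈ᶻ c ℤ.* coeff g i j
  coeff-constP*P c g i j = Z.trans (coeff-[r]*P (c ∷ []) g i j)
    (Z.trans (𝔽ₚ[y].coeff-≈ (𝔽ₚ[y].const-⊛ c (𝔽ₚ[y][x].coeff g i)) j)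
             (𝔽ₚ[y].coeff-• c (𝔽ₚ[y][x].coeff g i) j))

  coeff-X*P : ∀ f i j → coeff (X *P f) i j ≈ᶻ coeff ([] ∷ f) i j
  coeff-X*P f = coeff-≈ (P.trans (𝔽ₚ[y][x].≋-reflexive (*P≡⊛ˣ X f)) (𝔽ₚ[y][x].var-⊛ f))

  coeff-X*P-zero : ∀ f j → coeff (X *P f) 0 j ≈ᶻ 0ℤ
  coeff-X*P-zero f = coeff-X*P f 0

  coeff-X*P-suc : ∀ f i j → coeff (X *P f) (suc i) j ≈ᶻ coeff f i j
  coeff-X*P-suc f i = coeff-X*P f (suc i)

  coeff-Y*P : ∀ f i j → coeff (Y *P f) i j ≈ᶻ lookupD (0ℤ ∷ lookupD f [] i) 0ℤ j
  coeff-Y*P f i j =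
    Z.trans (coeff-[r]*P 𝔽ₚ[y].var f i j) (𝔽ₚ[y].coeff-≈ (𝔽ₚ[y].var-⊛ (lookupD f [] i)) j)

  coeff-Y*P-zero : ∀ f i → coeff (Y *P f) i 0 ≈ᶻ 0ℤ
  coeff-Y*P-zero f i = coeff-Y*P f i 0

  coeff-Y*P-suc : ∀ f i j → coeff (Y *P f) i (suc j) ≈ᶻ coeff f i j
  coeff-Y*P-suc f i j = coeff-Y*P f i (suc j)

  Regular : Poly → Set
  Regular z = ∀ {q} → z *P q ≈ 0P → q ≈ 0P

  ^P-suc-*P : ∀ z n q → (z ^P suc n) *P q ≈ z *P ((z ^P n) *P q)
  ^P-suc-*P z n q = P.*-assoc z (z ^P n) q

  ^P-regular : ∀ {z} → Regular z → ∀ n → Regular (z ^P n)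
  ^P-regular z-reg zero zq≈0 = P.trans (P.sym (P.*-identityˡ _)) zq≈0
  ^P-regular {z} z-reg (suc n) {q} zq≈0 = ^P-regular z-reg n (z-reg (P.trans (P.sym (^P-suc-*P z n q)) zq≈0))

  *P-regular : ∀ {y z} → Regular y → Regular z → Regular (y *P z)
  *P-regular {y} {z} y-reg z-reg {q} yzq≈0 = z-reg (y-reg (P.trans (P.sym (P.*-assoc y z q)) yzq≈0))

  X-regular : Regular X
  X-regular {q} Xq≈0 = 𝔽ₚ[y][x].mk≋ λ i → 𝔽ₚ[y].mk≋ λ j →
    Z.trans (Z.sym (coeff-X*P-suc q i j)) (coeff-≈ Xq≈0 (suc i) j)

  Y-regular : Regular Y
  Y-regular {q} Yq≈0 = 𝔽ₚ[y][x].mk≋ λ i → 𝔽ₚ[y].mk≋ λ j →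
    Z.trans (Z.sym (coeff-Y*P-suc q i j)) (coeff-≈ Yq≈0 i (suc j))

  coeff-X^*P-below : ∀ a f {i} j → i < a → coeff ((X ^P a) *P f) i j ≈ᶻ 0ℤ
  coeff-X^*P-below (suc a) f {zero} j _ =
    Z.trans (coeff-≈ (^P-suc-*P X a f) 0 j) (coeff-X*P-zero ((X ^P a) *P f) j)
  coeff-X^*P-below (suc a) f {suc i} j (s≤s i<a) = Z.trans (coeff-≈ (^P-suc-*P X a f) (suc i) j)
    (Z.trans (coeff-X*P-suc ((X ^P a) *P f) i j) (coeff-X^*P-below a f j i<a))

  coeff-X^*P-shift : ∀ a f i j → coeff ((X ^P a) *P f) (a + i) j ≈ᶻ coeff f i j
  coeff-X^*P-shift zero f i j = coeff-≈ (P.*-identityˡ f) i j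
  coeff-X^*P-shift (suc a) f i j = Z.trans (coeff-≈ (^P-suc-*P X a f) (suc a + i) j)
    (Z.trans (coeff-X*P-suc ((X ^P a) *P f) (a + i) j) (coeff-X^*P-shift a f i j))

  coeff-Y^*P-below : ∀ b f i {j} → j < b → coeff ((Y ^P b) *P f) i j ≈ᶻ 0ℤ
  coeff-Y^*P-below (suc b) f i {zero} _ =
    Z.trans (coeff-≈ (^P-suc-*P Y b f) i 0) (coeff-Y*P-zero ((Y ^P b) *P f) i)
  coeff-Y^*P-below (suc b) f i {suc j} (s≤s j<b) = Z.trans (coeff-≈ (^P-suc-*P Y b f) i (suc j))
    (Z.trans (coeff-Y*P-suc ((Y ^P b) *P f) i j) (coeff-Y^*P-below b f i j<b))

  coeff-Y^*P-shift : ∀ b f i j → coeff ((Y ^P b) *P f) i (b + j) ≈ᶻ coeff f i j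
  coeff-Y^*P-shift zero f i j = coeff-≈ (P.*-identityˡ f) i j
  coeff-Y^*P-shift (suc b) f i j = Z.trans (coeff-≈ (^P-suc-*P Y b f) i (suc b + j))
    (Z.trans (coeff-Y*P-suc ((Y ^P b) *P f) i (b + j)) (coeff-Y^*P-shift b f i j))

  X+Y : Poly
  X+Y = X +P Y

  coeff-X+Y*P : ∀ q i j → coeff (X+Y *P q) i j ≈ᶻ coeff (X *P q) i j ℤ.+ coeff (Y *P q) i j
  coeff-X+Y*P q i j = Z.trans (coeff-≈ (P.distribʳ q X Y) i j) (coeff-+P (X *P q) (Y *P q) i j)

  coeff-X+Y*P-0-0 : ∀ q → coeff (X+Y *P q) 0 0 ≈ᶻ 0ℤ
  coeff-X+Y*P-0-0 q = Z.trans (coeff-X+Y*P q 0 0)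
    (Z.trans (Z.+-cong (coeff-X*P-zero q 0) (coeff-Y*P-zero q 0)) (Z.+-identityˡ 0ℤ))

  coeff-X+Y*P-s-0 : ∀ q i → coeff (X+Y *P q) (suc i) 0 ≈ᶻ coeff q i 0
  coeff-X+Y*P-s-0 q i = Z.trans (coeff-X+Y*P q (suc i) 0)
    (Z.trans (Z.+-cong (coeff-X*P-suc q i 0) (coeff-Y*P-zero q (suc i))) (Z.+-identityʳ _))

  coeff-X+Y*P-0-s : ∀ q j → coeff (X+Y *P q) 0 (suc j) ≈ᶻ coeff q 0 j
  coeff-X+Y*P-0-s q j = Z.trans (coeff-X+Y*P q 0 (suc j))
    (Z.trans (Z.+-cong (coeff-X*P-zero q (suc j)) (coeff-Y*P-suc q 0 j)) (Z.+-identityˡ _))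

  coeff-X+Y*P-s-s : ∀ q i j → coeff (X+Y *P q) (suc i) (suc j) ≈ᶻ coeff q i (suc j) ℤ.+ coeff q (suc i) j
  coeff-X+Y*P-s-s q i j = Z.trans (coeff-X+Y*P q (suc i) (suc j))
    (Z.+-cong (coeff-X*P-suc q i (suc j)) (coeff-Y*P-suc q (suc i) j))

  X+Y-regular : Regular X+Y
  X+Y-regular {q} [X+Y]q≈0 = 𝔽ₚ[y][x].mk≋ λ i → 𝔽ₚ[y].mk≋ λ j → column j i
    where
    column : ∀ j i → coeff q i j ≈ᶻ 0ℤ
    column zero i = Z.trans (Z.sym (coeff-X+Y*P-s-0 q i)) (coeff-≈ [X+Y]q≈0 (suc i) 0)
    column (suc j) i = begin
      coeff q i (suc j)                        ≈⟨ Z.+-identityʳ _ ⟨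
      coeff q i (suc j) ℤ.+ 0ℤ                 ≈⟨ Z.+-cong (Z.refl {coeff q i (suc j)}) (column j (suc i)) ⟨
      coeff q i (suc j) ℤ.+ coeff q (suc i) j  ≈⟨ coeff-X+Y*P-s-s q i j ⟨
      coeff (X+Y *P q) (suc i) (suc j)         ≈⟨ coeff-≈ [X+Y]q≈0 (suc i) (suc j) ⟩
      0ℤ                                       ∎
      where open ≈ᶻ-Reasoning

  pascal : ∀ m i c → + (m C i) ℤ.* c ℤ.+ + (m C suc i) ℤ.* c ≈ᶻ + (suc m C suc i) ℤ.* c
  pascal m i c = begin
    + (m C i) ℤ.* c ℤ.+ + (m C suc i) ℤ.* c  ≈⟨ Z.distribʳ c (+ (m C i)) (+ (m C suc i)) ⟨
    (+ (m C i) ℤ.+ + (m C suc i)) ℤ.* c      ≡⟨ ≡.cong (ℤ._* c) (ℤᵖ.pos-+ (m C i) (m C suc i)) ⟨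
    + (m C i ℕ.+ m C suc i) ℤ.* c            ≡⟨ ≡.cong (λ k → + k ℤ.* c) (nCk+nC[k+1]≡[n+1]C[k+1] m i) ⟩
    + (suc m C suc i) ℤ.* c                  ∎
    where open ≈ᶻ-Reasoning

  coeff-X+Y^*P-below : ∀ m h i j → i + j < m → coeff ((X+Y ^P m) *P h) i j ≈ᶻ 0ℤ
  coeff-X+Y^*P-below (suc m) h i j i+j<1+m = Z.trans (coeff-≈ (^P-suc-*P X+Y m h) i j) (step i j i+j<1+m)
    where
    q = (X+Y ^P m) *P h
    step : ∀ i j → i + j < suc m → coeff (X+Y *P q) i j ≈ᶻ 0ℤ
    step zero zero _ = coeff-X+Y*P-0-0 q
    step (suc i) zero (s≤s i+0<m) = Z.trans (coeff-X+Y*P-s-0 q i) (coeff-X+Y^*P-below m h i 0 i+0<m)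
    step zero (suc j) (s≤s j<m) = Z.trans (coeff-X+Y*P-0-s q j) (coeff-X+Y^*P-below m h 0 j j<m)
    step (suc i) (suc j) (s≤s i+1+j<m) = Z.trans (coeff-X+Y*P-s-s q i j) (Z.trans
      (Z.+-cong (coeff-X+Y^*P-below m h i (suc j) i+1+j<m)
                (coeff-X+Y^*P-below m h (suc i) j (≡.subst (_< m) (ℕᵖ.+-suc i j) i+1+j<m)))
      (Z.+-identityˡ 0ℤ))

  coeff-X+Y^*P-top : ∀ m h i j → i + j ≡ m → coeff ((X+Y ^P m) *P h) i j ≈ᶻ + (m C i) ℤ.* coeff h 0 0
  coeff-X+Y^*P-top zero h zero zero _ = Z.trans (coeff-≈ (P.*-identityˡ h) 0 0) (Z.sym (Z.*-identityˡ _))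
  coeff-X+Y^*P-top (suc m) h i j i+j≡1+m = Z.trans (coeff-≈ (^P-suc-*P X+Y m h) i j) (step i j i+j≡1+m)
    where
    q = (X+Y ^P m) *P h
    c = coeff h 0 0
    step : ∀ i j → i + j ≡ suc m → coeff (X+Y *P q) i j ≈ᶻ + (suc m C i) ℤ.* c
    step zero (suc j) 1+j≡1+m =
      Z.trans (coeff-X+Y*P-0-s q j) (coeff-X+Y^*P-top m h 0 j (ℕᵖ.suc-injective 1+j≡1+m))
    step (suc i) zero 1+i+0≡1+m = begin
      coeff (X+Y *P q) (suc i) 0               ≈⟨ coeff-X+Y*P-s-0 q i ⟩
      coeff q i 0                              ≈⟨ coeff-X+Y^*P-top m h i 0 i+0≡m ⟩
      + (m C i) ℤ.* c                          ≈⟨ Z.+-identityʳ _ ⟨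
      + (m C i) ℤ.* c ℤ.+ 0ℤ
        ≡⟨ ≡.cong (λ k → + (m C i) ℤ.* c ℤ.+ + k ℤ.* c) (k>n⇒nCk≡0 m<1+i) ⟨
      + (m C i) ℤ.* c ℤ.+ + (m C suc i) ℤ.* c  ≈⟨ pascal m i c ⟩
      + (suc m C suc i) ℤ.* c                  ∎
      where
      open ≈ᶻ-Reasoning
      i+0≡m = ℕᵖ.suc-injective 1+i+0≡1+m
      m<1+i = ℕᵖ.≤-reflexive (≡.cong suc (≡.trans (≡.sym i+0≡m) (ℕᵖ.+-identityʳ i)))
    step (suc i) (suc j) 2+i+j≡1+m = Z.trans (coeff-X+Y*P-s-s q i j) (Z.trans
      (Z.+-cong (coeff-X+Y^*P-top m h i (suc j) (ℕᵖ.suc-injective 2+i+j≡1+m))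
                (coeff-X+Y^*P-top m h (suc i) j
                   (≡.trans (≡.sym (ℕᵖ.+-suc i j)) (ℕᵖ.suc-injective 2+i+j≡1+m))))
      (pascal m i c))

  coeff-X+Y^-off : ∀ m i j → i + j ≢ m → coeff (X+Y ^P m) i j ≈ᶻ 0ℤ
  coeff-X+Y^-off zero zero zero i+j≢0 = contradiction ≡.refl i+j≢0
  coeff-X+Y^-off zero zero (suc j) _ = Z.refl
  coeff-X+Y^-off zero (suc i) j _ = Z.refl
  coeff-X+Y^-off (suc m) zero zero _ = coeff-X+Y*P-0-0 (X+Y ^P m)
  coeff-X+Y^-off (suc m) (suc i) zero i+0≢m =
    Z.trans (coeff-X+Y*P-s-0 (X+Y ^P m) i) (coeff-X+Y^-off m i 0 (i+0≢m ∘ ≡.cong suc))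
  coeff-X+Y^-off (suc m) zero (suc j) j≢m =
    Z.trans (coeff-X+Y*P-0-s (X+Y ^P m) j) (coeff-X+Y^-off m 0 j (j≢m ∘ ≡.cong suc))
  coeff-X+Y^-off (suc m) (suc i) (suc j) i+j≢m = Z.trans (coeff-X+Y*P-s-s (X+Y ^P m) i j) (Z.trans
    (Z.+-cong (coeff-X+Y^-off m i (suc j) (i+j≢m ∘ ≡.cong suc))
              (coeff-X+Y^-off m (suc i) j (i+j≢m ∘ ≡.cong suc ∘ ≡.trans (ℕᵖ.+-suc i j))))
    (Z.+-identityˡ 0ℤ))

  monomial : ℕ → ℕ → Poly
  monomial a b = (X ^P a) *P (Y ^P b)

  monomial-regular : ∀ a b → Regular (monomial a b)
  monomial-regular a b = *P-regular {X ^P a} {Y ^P b} (^P-regular X-regular a) (^P-regular Y-regular b)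

  coeff-monomial-off : ∀ a b i j → ¬ (i ≡ a × j ≡ b) → coeff (monomial a b) i j ≈ᶻ 0ℤ
  coeff-monomial-off a b i j ≢a,b with split a i
  ... | below i<a = coeff-X^*P-below a (Y ^P b) j i<a
  ... | above k = Z.trans (coeff-X^*P-shift a (Y ^P b) k j)
                    (Z.trans (coeff-≈ (P.sym (P.*-identityʳ (Y ^P b))) k j) (coeff-Y^*P-1 j ≢a,b))
    where
    coeff-Y^*P-1 : ∀ j → ¬ (a + k ≡ a × j ≡ b) → coeff ((Y ^P b) *P constP 1ℤ) k j ≈ᶻ 0ℤ
    coeff-Y^*P-1 j ≢a,b with split b j
    ... | below j<b = coeff-Y^*P-below b (constP 1ℤ) k j<b
    ... | above l = Z.trans (coeff-Y^*P-shift b (constP 1ℤ) k l) (coeff-1 k l ≢a,b)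
      where
      coeff-1 : ∀ k l → ¬ (a + k ≡ a × b + l ≡ b) → coeff (constP 1ℤ) k l ≈ᶻ 0ℤ
      coeff-1 zero zero ≢a,b = contradiction (ℕᵖ.+-identityʳ a , ℕᵖ.+-identityʳ b) ≢a,b
      coeff-1 zero (suc l) _ = Z.refl
      coeff-1 (suc k) l _ = Z.refl

  coeff-monomial-diag : ∀ a b → coeff (monomial a b) a b ≈ᶻ 1ℤ
  coeff-monomial-diag a b = begin
    coeff (monomial a b) a b                 ≡⟨ ≡.cong (λ i → coeff (monomial a b) i b) (ℕᵖ.+-identityʳ a) ⟨
    coeff (monomial a b) (a + 0) b           ≈⟨ coeff-X^*P-shift a (Y ^P b) 0 b ⟩
    coeff (Y ^P b) 0 b                       ≈⟨ coeff-≈ (P.*-identityʳ (Y ^P b)) 0 b ⟨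
    coeff ((Y ^P b) *P constP 1ℤ) 0 b        ≡⟨ ≡.cong (coeff ((Y ^P b) *P constP 1ℤ) 0) (ℕᵖ.+-identityʳ b) ⟨
    coeff ((Y ^P b) *P constP 1ℤ) 0 (b + 0)  ≈⟨ coeff-Y^*P-shift b (constP 1ℤ) 0 0 ⟩
    1ℤ                                       ∎
    where open ≈ᶻ-Reasoning

  coeff-binomTerm-off : ∀ m k i j → ¬ (i ≡ k × i + j ≡ m) → coeff (binomTerm m k) i j ≈ᶻ 0ℤ
  coeff-binomTerm-off m k i j ≢k,m = Z.trans (coeff-constP*P (+ (m C k)) (monomial k (m ∸ k)) i j) vanish
    where
    vanish : + (m C k) ℤ.* coeff (monomial k (m ∸ k)) i j ≈ᶻ 0ℤ
    vanish with i ℕ.≟ k | j ℕ.≟ m ∸ k | k ℕ.≤? m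
    ... | yes ≡.refl | yes ≡.refl | yes k≤m = contradiction (≡.refl , ℕᵖ.m+[n∸m]≡n k≤m) ≢k,m
    ... | yes ≡.refl | yes ≡.refl | no k≰m = Z.trans
      (Z.*-cong (Z.reflexive (≡.cong +_ (k>n⇒nCk≡0 (ℕᵖ.≰⇒> k≰m))))
                (Z.refl {coeff (monomial k (m ∸ k)) k j}))
      (Z.zeroˡ (coeff (monomial k (m ∸ k)) k j))
    ... | no i≢k | _ | _ = Z.trans
      (Z.*-cong (Z.refl {+ (m C k)}) (coeff-monomial-off k (m ∸ k) i j (i≢k ∘ proj₁))) (Z.zeroʳ (+ (m C k)))
    ... | yes _ | no j≢m-k | _ = Z.trans
      (Z.*-cong (Z.refl {+ (m C k)}) (coeff-monomial-off k (m ∸ k) i j (j≢m-k ∘ proj₂))) (Z.zeroʳ (+ (m C k)))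

  coeff-binomTerm-≢ : ∀ m {k} i j → k ≢ i → coeff (binomTerm m k) i j ≈ᶻ 0ℤ
  coeff-binomTerm-≢ m {k} i j k≢i = coeff-binomTerm-off m k i j (k≢i ∘ ≡.sym ∘ proj₁)

  coeff-binomTerm-diag : ∀ m i j → i + j ≡ m → coeff (binomTerm m i) i j ≈ᶻ + (m C i)
  coeff-binomTerm-diag _ i j ≡.refl = begin
    coeff (binomTerm (i + j) i) i j
      ≈⟨ coeff-constP*P (+ ((i + j) C i)) (monomial i ((i + j) ∸ i)) i j ⟩
    + ((i + j) C i) ℤ.* coeff (monomial i ((i + j) ∸ i)) i j
      ≡⟨ ≡.cong (λ l → + ((i + j) C i) ℤ.* coeff (monomial i l) i j) (ℕᵖ.m+n∸m≡n i j) ⟩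
    + ((i + j) C i) ℤ.* coeff (monomial i j) i j
      ≈⟨ Z.*-cong (Z.refl {+ ((i + j) C i)}) (coeff-monomial-diag i j) ⟩
    + ((i + j) C i) ℤ.* 1ℤ
      ≈⟨ Z.*-identityʳ _ ⟩
    + ((i + j) C i)
      ∎
    where open ≈ᶻ-Reasoning

  coeff-binomTerm-≈0 : ∀ m k i j → (i ≡ k → i + j ≡ m → + (m C i) ≈ᶻ 0ℤ) →
                       coeff (binomTerm m k) i j ≈ᶻ 0ℤ
  coeff-binomTerm-≈0 m k i j C≈0 with i ℕ.≟ k | i + j ℕ.≟ m
  ... | yes ≡.refl | yes i+j≡m = Z.trans (coeff-binomTerm-diag m i j i+j≡m) (C≈0 ≡.refl i+j≡m)
  ... | no i≢k | _ = coeff-binomTerm-off m k i j (i≢k ∘ proj₁)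
  ... | yes _ | no i+j≢m = coeff-binomTerm-off m k i j (i+j≢m ∘ proj₂)

  coeff-sumP-vanish : ∀ {i j} t L → (∀ {k} → k ∈ L → coeff (t k) i j ≈ᶻ 0ℤ) →
                      coeff (sumP L t) i j ≈ᶻ 0ℤ
  coeff-sumP-vanish t [] _ = Z.refl
  coeff-sumP-vanish {i} {j} t (k ∷ L) vanish = Z.trans (coeff-+P (t k) (sumP L t) i j)
    (Z.trans (Z.+-cong (vanish (here ≡.refl)) (coeff-sumP-vanish t L (vanish ∘ there))) (Z.+-identityˡ 0ℤ))

  coeff-sumP-unique : ∀ {i j k} t L → Unique L → k ∈ L → (∀ {l} → l ≢ k → coeff (t l) i j ≈ᶻ 0ℤ) →
                      coeff (sumP L t) i j ≈ᶻ coeff (t k) i j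
  coeff-sumP-unique {i} {j} t (k ∷ L) (k∉L ∷ _) (here ≡.refl) vanish =
    Z.trans (coeff-+P (t k) (sumP L t) i j)
      (Z.trans (Z.+-cong (Z.refl {coeff (t k) i j})
                         (coeff-sumP-vanish t L (λ l∈L → vanish (≡.≢-sym (All.lookup k∉L l∈L)))))
               (Z.+-identityʳ _))
  coeff-sumP-unique {i} {j} t (l ∷ L) (l∉L ∷ L-unique) (there k∈L) vanish =
    Z.trans (coeff-+P (t l) (sumP L t) i j)
      (Z.trans (Z.+-cong (vanish (All.lookup l∉L k∈L)) (coeff-sumP-unique t L L-unique k∈L vanish))
               (Z.+-identityˡ _))

  infix 4 _∣ᴾ_
  record _∣ᴾ_ (d f : Poly) : Set where
    constructor divides
    field
      quotient : Poly
      equality : f ≈ d *P quotient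

  Divides⇒∣ᴾ : ∀ {d f} → Divides p d f → d ∣ᴾ f
  Divides⇒∣ᴾ (q , f≈dq) = divides q (≈[]⇒≈ f≈dq)

  ∣ᴾ-respʳ-≈ : ∀ {d f g} → f ≈ g → d ∣ᴾ f → d ∣ᴾ g
  ∣ᴾ-respʳ-≈ f≈g (divides q f≈dq) = divides q (P.trans (P.sym f≈g) f≈dq)

  ∣ᴾ-*P : ∀ {d f} g → d ∣ᴾ f → d ∣ᴾ g *P f
  ∣ᴾ-*P {d} g (divides q f≈dq) = divides (g *P q) (P.trans (*P-congˡ g f≈dq) (x∙yz≈y∙xz g d q))

  ∣ᴾ-− : ∀ {d f g} → d ∣ᴾ f → d ∣ᴾ g → d ∣ᴾ f +P negP g
  ∣ᴾ-− {d} {f} {g} (divides q f≈dq) (divides r g≈dr) = divides (q +P negP r) $ begin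
    f +P negP g              ≈⟨ P.+-cong f≈dq (P.-‿cong g≈dr) ⟩
    d *P q +P negP (d *P r)  ≈⟨ +P-congˡ (d *P q) (-‿distribʳ-* d r) ⟩
    d *P q +P d *P negP r    ≈⟨ P.distribˡ d q (negP r) ⟨
    d *P (q +P negP r)       ∎
    where open ≈-Reasoning

  X^∣⇒coeff≈0 : ∀ a {f} → X ^P a ∣ᴾ f → ∀ {i} j → i < a → coeff f i j ≈ᶻ 0ℤ
  X^∣⇒coeff≈0 a (divides q f≈X^q) {i} j i<a = Z.trans (coeff-≈ f≈X^q i j) (coeff-X^*P-below a q j i<a)

  Y^∣⇒coeff≈0 : ∀ b {f} → Y ^P b ∣ᴾ f → ∀ i {j} → j < b → coeff f i j ≈ᶻ 0ℤ
  Y^∣⇒coeff≈0 b (divides q f≈Y^q) i {j} j<b = Z.trans (coeff-≈ f≈Y^q i j) (coeff-Y^*P-below b q i j<b)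

  coeff≈0⇒X^∣ : ∀ a f → (∀ {i} j → i < a → coeff f i j ≈ᶻ 0ℤ) → X ^P a ∣ᴾ f
  coeff≈0⇒X^∣ a f low = divides (drop a f) $ 𝔽ₚ[y][x].mk≋ λ i → 𝔽ₚ[y].mk≋ λ j → compare i j
    where
    compare : ∀ i j → coeff f i j ≈ᶻ coeff ((X ^P a) *P drop a f) i j
    compare i j with split a i
    ... | below i<a = Z.trans (low j i<a) (Z.sym (coeff-X^*P-below a (drop a f) j i<a))
    ... | above k = Z.trans (Z.reflexive (≡.cong (λ row → lookupD row 0ℤ j) (≡.sym (lookupD-drop a f [] k))))
                            (Z.sym (coeff-X^*P-shift a (drop a f) k j))

  coeff≈0⇒Y^∣ : ∀ b f → (∀ i {j} → j < b → coeff f i j ≈ᶻ 0ℤ) → Y ^P b ∣ᴾ f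
  coeff≈0⇒Y^∣ b f low = divides (map (drop b) f) $ 𝔽ₚ[y][x].mk≋ λ i → 𝔽ₚ[y].mk≋ λ j → compare i j
    where
    coeff-map-drop : ∀ i l → coeff (map (drop b) f) i l ≡ coeff f i (b + l)
    coeff-map-drop i l = ≡.trans
      (≡.cong (λ row → lookupD row 0ℤ l)
        (≡.trans (≡.cong (λ d → lookupD (map (drop b) f) d i) (≡.sym (drop-[] b)))
                 (lookupD-map (drop b) f [] i)))
      (lookupD-drop b (lookupD f [] i) 0ℤ l)
    compare : ∀ i j → coeff f i j ≈ᶻ coeff ((Y ^P b) *P map (drop b) f) i j
    compare i j with split b j
    ... | below j<b = Z.trans (low i j<b) (Z.sym (coeff-Y^*P-below b (map (drop b) f) i j<b))
    ... | above l = Z.trans (Z.reflexive (≡.sym (coeff-map-drop i l)))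
                            (Z.sym (coeff-Y^*P-shift b (map (drop b) f) i l))

  X^∣∧Y^∣⇒monomial∣ : ∀ a b {f} → X ^P a ∣ᴾ f → Y ^P b ∣ᴾ f → monomial a b ∣ᴾ f
  X^∣∧Y^∣⇒monomial∣ a b {f} (divides u f≈X^u) Y^b∣f =
    divides v (P.trans f≈X^u (P.trans (*P-congˡ (X ^P a) u≈Y^v) (P.sym (P.*-assoc (X ^P a) (Y ^P b) v))))
    where
    u-low : ∀ i {j} → j < b → coeff u i j ≈ᶻ 0ℤ
    u-low i {j} j<b = Z.trans (Z.sym (coeff-X^*P-shift a u i j))
      (Z.trans (Z.sym (coeff-≈ f≈X^u (a + i) j)) (Y^∣⇒coeff≈0 b Y^b∣f (a + i) j<b))
    open _∣ᴾ_ (coeff≈0⇒Y^∣ b u u-low) renaming (quotient to v; equality to u≈Y^v)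

  x-y≈0⇒x≈y : ∀ {x y} → x +P negP y ≈ 0P → x ≈ y
  x-y≈0⇒x≈y {x} {y} = x∙y⁻¹≈ε⇒x≈y x y

  -- The ring solver does not cancel opposite terms here (it has no zero test on coefficients),
  -- so each identity below is routed through one whose two sides have the same monomials.
  a+b≈c+d⇒a-c≈d-b : ∀ a b c d → a +P b ≈ c +P d → a +P negP c ≈ d +P negP b
  a+b≈c+d⇒a-c≈d-b a b c d a+b≈c+d = x-y≈0⇒x≈y $ begin
    (a +P negP c) +P negP (d +P negP b)  ≈⟨ regroup a b c d ⟩
    (a +P b) +P negP (c +P d)            ≈⟨ P.+-congʳ a+b≈c+d ⟩
    (c +P d) +P negP (c +P d)            ≈⟨ P.-‿inverseʳ (c +P d) ⟩
    0P                                   ∎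
    where
    open ≈-Reasoning
    regroup : ∀ a b c d → (a +P negP c) +P negP (d +P negP b) ≈ (a +P b) +P negP (c +P d)
    regroup = solve-∀ almostCommutativeRing

  x-f≈mq⇒f≈x+q[-m] : ∀ x f m q → x +P negP f ≈ m *P q → f ≈ x +P q *P negP m
  x-f≈mq⇒f≈x+q[-m] x f m q x-f≈mq = P.sym $ x-y≈0⇒x≈y $ begin
    (x +P q *P negP m) +P negP f    ≈⟨ regroup x f m q ⟩
    (x +P negP f) +P negP (m *P q)  ≈⟨ P.+-congʳ x-f≈mq ⟩
    m *P q +P negP (m *P q)         ≈⟨ P.-‿inverseʳ (m *P q) ⟩
    0P                              ∎
    where
    open ≈-Reasoning
    regroup : ∀ x f m q → (x +P q *P negP m) +P negP f ≈ (x +P negP f) +P negP (m *P q)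
    regroup = solve-∀ almostCommutativeRing

  g-y≈mq⇒g≈y+qm : ∀ g y m q → g +P negP y ≈ m *P q → g ≈ y +P q *P m
  g-y≈mq⇒g≈y+qm g y m q g-y≈mq = P.sym $ x-y≈0⇒x≈y $ begin
    (y +P q *P m) +P negP g       ≈⟨ regroup g y m q ⟩
    m *P q +P negP (g +P negP y)  ≈⟨ +P-congˡ (m *P q) (P.-‿cong g-y≈mq) ⟩
    m *P q +P negP (m *P q)       ≈⟨ P.-‿inverseʳ (m *P q) ⟩
    0P                            ∎
    where
    open ≈-Reasoning
    regroup : ∀ g y m q → (y +P q *P m) +P negP g ≈ m *P q +P negP (g +P negP y)
    regroup = solve-∀ almostCommutativeRing

  θxy-cong : ∀ θ θ′ → θ ≈D[ p ] θ′ → θxy θ ≈ θxy θ′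
  θxy-cong (f , g) (f′ , g′) (f≈f′ , g≈g′) = P.+-cong (≈[]⇒≈ {f} {f′} f≈f′) (≈[]⇒≈ {g} {g′} g≈g′)

  θxy-linear : ∀ α θ₁ β θ₂ → θxy ((α ·D θ₁) +D (β ·D θ₂)) ≈ α *P θxy θ₁ +P β *P θxy θ₂
  θxy-linear α (f₁ , g₁) β (f₂ , g₂) = regroup α f₁ g₁ β f₂ g₂
    where
    regroup : ∀ α f₁ g₁ β f₂ g₂ →
              (α *P f₁ +P β *P f₂) +P (α *P g₁ +P β *P g₂) ≈ α *P (f₁ +P g₁) +P β *P (f₂ +P g₂)
    regroup = solve-∀ almostCommutativeRing

module Arrangement (p : ℕ) where

  open import Data.Nat using (_<_; _≤_; _+_)
  open import Data.Nat.Combinatorics using (_C_)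
  open import Defs
  open Bivariate p
  open ℤ-mod p using () renaming (_≈_ to _≈ᶻ_)

  BinomialsVanish : ℕ → ℕ → ℕ → Set
  BinomialsVanish m a b = ∀ i j → i < a → j < b → i + j ≡ m → p ℕ∣.∣ m C i

  InD-intro : ∀ μ {θ} → X ^P μ₁ μ ∣ᴾ θx θ → Y ^P μ₂ μ ∣ᴾ θy θ → X+Y ^P μ₃ μ ∣ᴾ θxy θ →
              InD p μ θ
  InD-intro _ (divides u θx≈) (divides v θy≈) (divides h θxy≈) =
    (u , ≈⇒≈[] θx≈) , (v , ≈⇒≈[] θy≈) , (h , ≈⇒≈[] θxy≈)

  module Ψ (m a b : ℕ) where

    μ : Mult
    μ = (a , b , m)

    ψx ψy : Poly
    ψx = proj₁ (ψ m μ)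
    ψy = proj₂ (ψ m μ)

    coeff-ψx-below : ∀ {i} j → i < a → coeff ψx i j ≈ᶻ 0ℤ
    coeff-ψx-below {i} j i<a = coeff-sumP-vanish (binomTerm m) (range a m) λ {k} k∈range →
      coeff-binomTerm-≈0 m k i j λ { ≡.refl _ → contradiction (∈-range⁻ k∈range) (ℕᵖ.<⇒≱ i<a) }

    coeff-ψy-below : BinomialsVanish m a b → ∀ i {j} → j < b → coeff ψy i j ≈ᶻ 0ℤ
    coeff-ψy-below vanish i {j} j<b = coeff-sumP-vanish (binomTerm m) (upTo a) λ {k} k∈upTo →
      coeff-binomTerm-≈0 m k i j λ { ≡.refl i+j≡m →
        ℤ-mod.∣⇒≈0 p (vanish i j (∈-upTo⁻ k∈upTo) j<b i+j≡m) }

    coeff-ψx-off : ∀ i j → i + j ≢ m → coeff ψx i j ≈ᶻ 0ℤ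
    coeff-ψx-off i j i+j≢m = coeff-sumP-vanish (binomTerm m) (range a m) λ {k} _ →
      coeff-binomTerm-≈0 m k i j λ _ i+j≡m → contradiction i+j≡m i+j≢m

    coeff-ψy-off : ∀ i j → i + j ≢ m → coeff ψy i j ≈ᶻ 0ℤ
    coeff-ψy-off i j i+j≢m = coeff-sumP-vanish (binomTerm m) (upTo a) λ {k} _ →
      coeff-binomTerm-≈0 m k i j λ _ i+j≡m → contradiction i+j≡m i+j≢m

    coeff-ψx+ψy-top : ∀ i j → i + j ≡ m → coeff (ψx +P ψy) i j ≈ᶻ + (m C i)
    coeff-ψx+ψy-top i j i+j≡m with i ℕ.<? a
    ... | yes i<a = begin
      coeff (ψx +P ψy) i j              ≈⟨ coeff-+P ψx ψy i j ⟩
      coeff ψx i j ℤ.+ coeff ψy i j     ≈⟨ Z.+-cong (coeff-ψx-below j i<a) ψy-single ⟩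
      0ℤ ℤ.+ coeff (binomTerm m i) i j  ≈⟨ Z.+-identityˡ _ ⟩
      coeff (binomTerm m i) i j         ≈⟨ coeff-binomTerm-diag m i j i+j≡m ⟩
      + (m C i)                         ∎
      where
      open ≈ᶻ-Reasoning
      ψy-single = coeff-sumP-unique (binomTerm m) (upTo a) (Unique.upTo⁺ a) (∈-upTo⁺ i<a)
                                    (coeff-binomTerm-≢ m i j)
    ... | no i≮a = begin
      coeff (ψx +P ψy) i j              ≈⟨ coeff-+P ψx ψy i j ⟩
      coeff ψx i j ℤ.+ coeff ψy i j     ≈⟨ Z.+-cong ψx-single ψy≈0 ⟩
      coeff (binomTerm m i) i j ℤ.+ 0ℤ  ≈⟨ Z.+-identityʳ _ ⟩
      coeff (binomTerm m i) i j         ≈⟨ coeff-binomTerm-diag m i j i+j≡m ⟩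
      + (m C i)                         ∎
      where
      open ≈ᶻ-Reasoning
      i∈range = ∈-range⁺ (ℕᵖ.≮⇒≥ i≮a) (≡.subst (i ≤_) i+j≡m (ℕᵖ.m≤m+n i j))
      ψx-single = coeff-sumP-unique (binomTerm m) (range a m) (range-unique a m) i∈range
                                    (coeff-binomTerm-≢ m i j)
      ψy≈0 = coeff-sumP-vanish (binomTerm m) (upTo a) λ {k} k∈upTo →
        coeff-binomTerm-≈0 m k i j λ { ≡.refl _ → contradiction (∈-upTo⁻ k∈upTo) i≮a }

    ψx+ψy≈[X+Y]^m : ψx +P ψy ≈ X+Y ^P m
    ψx+ψy≈[X+Y]^m = 𝔽ₚ[y][x].mk≋ λ i → 𝔽ₚ[y].mk≋ λ j → compare i j
      where
      open ≈ᶻ-Reasoning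
      compare : ∀ i j → coeff (ψx +P ψy) i j ≈ᶻ coeff (X+Y ^P m) i j
      compare i j with i + j ℕ.≟ m
      ... | yes i+j≡m = Z.trans (coeff-ψx+ψy-top i j i+j≡m) $ Z.sym $ begin
        coeff (X+Y ^P m) i j                 ≈⟨ coeff-≈ (P.*-identityʳ (X+Y ^P m)) i j ⟨
        coeff ((X+Y ^P m) *P constP 1ℤ) i j  ≈⟨ coeff-X+Y^*P-top m (constP 1ℤ) i j i+j≡m ⟩
        + (m C i) ℤ.* 1ℤ                     ≈⟨ Z.*-identityʳ _ ⟩
        + (m C i)                            ∎
      ... | no i+j≢m = Z.trans (coeff-+P ψx ψy i j)
        (Z.trans (Z.+-cong (coeff-ψx-off i j i+j≢m) (coeff-ψy-off i j i+j≢m))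
          (Z.trans (Z.+-identityˡ 0ℤ) (Z.sym (coeff-X+Y^-off m i j i+j≢m))))

    X^a∣ψx : X ^P a ∣ᴾ ψx
    X^a∣ψx = coeff≈0⇒X^∣ a ψx coeff-ψx-below

    Y^b∣ψy : BinomialsVanish m a b → Y ^P b ∣ᴾ ψy
    Y^b∣ψy vanish = coeff≈0⇒Y^∣ b ψy (coeff-ψy-below vanish)

    ψ∈D : BinomialsVanish m a b → InD p μ (ψ m μ)
    ψ∈D vanish = InD-intro μ X^a∣ψx (Y^b∣ψy vanish)
      (divides (constP 1ℤ) (P.trans ψx+ψy≈[X+Y]^m (P.sym (P.*-identityʳ (X+Y ^P m)))))

    ψ′∈D : InD p μ (ψ′ μ)
    ψ′∈D = InD-intro μ (divides (negP (Y ^P b)) (-‿distribʳ-* (X ^P a) (Y ^P b)))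
                       (divides (X ^P a) (P.*-comm (X ^P a) (Y ^P b)))
                       (divides 0P (P.trans (P.-‿inverseˡ (monomial a b)) (P.sym (P.zeroʳ (X+Y ^P m)))))
      where open import Algebra.Properties.Ring P.ring using (-‿distribʳ-*)

    ψ-spans : BinomialsVanish m a b → ∀ θ → InD p μ θ →
              ∃₂ λ α β → θ ≈D[ p ] ((α ·D ψ m μ) +D (β ·D ψ′ μ))
    ψ-spans vanish (f , g) (X^a∣f , Y^b∣g , (h , f+g≈[X+Y]^mh)) = h , q , ≈⇒≈[] f≈ , ≈⇒≈[] g≈
      where
      hψx+hψy≈f+g : h *P ψx +P h *P ψy ≈ f +P g
      hψx+hψy≈f+g = begin
        h *P ψx +P h *P ψy  ≈⟨ P.distribˡ h ψx ψy ⟨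
        h *P (ψx +P ψy)     ≈⟨ *P-congˡ h ψx+ψy≈[X+Y]^m ⟩
        h *P (X+Y ^P m)     ≈⟨ P.*-comm h (X+Y ^P m) ⟩
        (X+Y ^P m) *P h     ≈⟨ ≈[]⇒≈ f+g≈[X+Y]^mh ⟨
        f +P g              ∎
        where open ≈-Reasoning
      hψx-f≈g-hψy : h *P ψx +P negP f ≈ g +P negP (h *P ψy)
      hψx-f≈g-hψy = a+b≈c+d⇒a-c≈d-b (h *P ψx) (h *P ψy) f g hψx+hψy≈f+g
      monomial∣hψx-f : monomial a b ∣ᴾ h *P ψx +P negP f
      monomial∣hψx-f = X^∣∧Y^∣⇒monomial∣ a b
        (∣ᴾ-− (∣ᴾ-*P h X^a∣ψx) (Divides⇒∣ᴾ X^a∣f))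
        (∣ᴾ-respʳ-≈ (P.sym hψx-f≈g-hψy) (∣ᴾ-− (Divides⇒∣ᴾ Y^b∣g) (∣ᴾ-*P h (Y^b∣ψy vanish))))
      open _∣ᴾ_ monomial∣hψx-f renaming (quotient to q; equality to hψx-f≈mq)
      f≈ : f ≈ h *P ψx +P q *P negP (monomial a b)
      f≈ = x-f≈mq⇒f≈x+q[-m] (h *P ψx) f (monomial a b) q hψx-f≈mq
      g≈ : g ≈ h *P ψy +P q *P monomial a b
      g≈ = g-y≈mq⇒g≈y+qm g (h *P ψy) (monomial a b) q (P.trans (P.sym hψx-f≈g-hψy) hψx-f≈mq)

    ψ-independent : ∀ α β → ((α ·D ψ m μ) +D (β ·D ψ′ μ)) ≈D[ p ] 0D →
                    (α ≈[ p ] 0P) × (β ≈[ p ] 0P)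
    ψ-independent α β (x-part≈0 , y-part≈0) = ≈⇒≈[] α≈0 , ≈⇒≈[] β≈0
      where
      open ≈-Reasoning
      mon = monomial a b
      αψx-βm≈0 : α *P ψx +P β *P negP mon ≈ 0P
      αψx-βm≈0 = ≈[]⇒≈ x-part≈0
      αψy+βm≈0 : α *P ψy +P β *P mon ≈ 0P
      αψy+βm≈0 = ≈[]⇒≈ y-part≈0
      [X+Y]^mα≈0 : (X+Y ^P m) *P α ≈ 0P
      [X+Y]^mα≈0 = begin
        (X+Y ^P m) *P α                                      ≈⟨ P.*-comm (X+Y ^P m) α ⟩
        α *P (X+Y ^P m)                                      ≈⟨ *P-congˡ α ψx+ψy≈[X+Y]^m ⟨
        α *P (ψx +P ψy)                                      ≈⟨ P.+-identityʳ _ ⟨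
        α *P (ψx +P ψy) +P 0P                                ≈⟨ +P-congˡ (α *P (ψx +P ψy)) β[-m+m]≈0 ⟨
        α *P (ψx +P ψy) +P β *P (negP mon +P mon)            ≈⟨ θxy-linear α (ψ m μ) β (ψ′ μ) ⟨
        (α *P ψx +P β *P negP mon) +P (α *P ψy +P β *P mon)  ≈⟨ P.+-cong αψx-βm≈0 αψy+βm≈0 ⟩
        0P +P 0P                                             ≈⟨ P.+-identityʳ 0P ⟩
        0P                                                   ∎
        where β[-m+m]≈0 = P.trans (*P-congˡ β (P.-‿inverseˡ mon)) (P.zeroʳ β)
      α≈0 : α ≈ 0P
      α≈0 = ^P-regular X+Y-regular m [X+Y]^mα≈0
      β≈0 : β ≈ 0P
      β≈0 = monomial-regular a b $ begin
        mon *P β             ≈⟨ P.*-comm mon β ⟩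
        β *P mon             ≈⟨ P.+-identityˡ _ ⟨
        0P +P β *P mon       ≈⟨ P.+-congʳ (P.trans (P.*-congʳ α≈0) (P.zeroˡ ψy)) ⟨
        α *P ψy +P β *P mon  ≈⟨ αψy+βm≈0 ⟩
        0P                   ∎

    binomialsVanish⇒ψ-basis : BinomialsVanish m a b → IsBasis p μ (ψ m μ) (ψ′ μ)
    binomialsVanish⇒ψ-basis vanish = ψ∈D vanish , ψ′∈D , ψ-spans vanish , ψ-independent

    ψ-homogeneous : HomogeneousDer p m (ψ m μ)
    ψ-homogeneous = (λ i j i+j≢m → ℤ-mod.≈0⇒∣ p (coeff-ψx-off i j i+j≢m))
                  , (λ i j i+j≢m → ℤ-mod.≈0⇒∣ p (coeff-ψy-off i j i+j≢m))

    ψ′-homogeneous : HomogeneousDer p (a + b) (ψ′ μ)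
    ψ′-homogeneous =
        (λ i j i+j≢a+b → ℤ-mod.≈0⇒∣ p $
           Z.trans (coeff-negP (monomial a b) i j) (Z.-‿cong (monomial-off i j i+j≢a+b)))
      , (λ i j i+j≢a+b → ℤ-mod.≈0⇒∣ p (monomial-off i j i+j≢a+b))
      where
      monomial-off : ∀ i j → i + j ≢ a + b → coeff (monomial a b) i j ≈ᶻ 0ℤ
      monomial-off i j i+j≢a+b = coeff-monomial-off a b i j λ { (≡.refl , ≡.refl) → i+j≢a+b ≡.refl }

    ψ-basis⇒exp : IsBasis p μ (ψ m μ) (ψ′ μ) → ExpIs p μ m (a + b)
    ψ-basis⇒exp basis = ψ m μ , ψ′ μ , basis , ψ-homogeneous , ψ′-homogeneous

  +P-homogeneous : ∀ d f g → Homogeneous p d f → Homogeneous p d g → Homogeneous p d (f +P g)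
  +P-homogeneous d f g f-hom g-hom i j i+j≢d = ℤ-mod.≈0⇒∣ p $ Z.trans (coeff-+P f g i j)
    (Z.trans (Z.+-cong (ℤ-mod.∣⇒≈0 p {coeff f i j} (f-hom i j i+j≢d))
                       (ℤ-mod.∣⇒≈0 p {coeff g i j} (g-hom i j i+j≢d)))
             (Z.+-identityˡ 0ℤ))

  homogeneous-multiple≈0 : ∀ d m F h → Homogeneous p d F → d ≤ m → F ≈ (X+Y ^P m) *P h →
                           coeff h 0 0 ≈ᶻ 0ℤ → F ≈ 0P
  homogeneous-multiple≈0 d m F h F-hom d≤m F≈[X+Y]^mh h₀₀≈0 =
    𝔽ₚ[y][x].mk≋ λ i → 𝔽ₚ[y].mk≋ λ j → vanish i j
    where
    vanish : ∀ i j → coeff F i j ≈ᶻ 0ℤ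
    vanish i j with i + j ℕ.≟ d | ℕᵖ.m≤n⇒m<n∨m≡n d≤m
    ... | no i+j≢d | _ = ℤ-mod.∣⇒≈0 p (F-hom i j i+j≢d)
    ... | yes ≡.refl | inj₁ i+j<m = Z.trans (coeff-≈ F≈[X+Y]^mh i j) (coeff-X+Y^*P-below m h i j i+j<m)
    ... | yes ≡.refl | inj₂ i+j≡m = Z.trans (coeff-≈ F≈[X+Y]^mh i j)
      (Z.trans (coeff-X+Y^*P-top m h i j i+j≡m)
               (Z.trans (Z.*-cong (Z.refl {+ (m C i)}) h₀₀≈0) (Z.zeroʳ (+ (m C i)))))

  low-degree-θxy≈0⇒θ≈0 : ∀ μ θ d → InD p μ θ → HomogeneousDer p d θ → d < μ₁ μ + μ₂ μ → θxy θ ≈ 0P →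
                          θx θ ≈ 0P × θy θ ≈ 0P
  low-degree-θxy≈0⇒θ≈0 (a , b , _) (f , g) d ((u , f≈X^u) , (v , g≈Y^v) , _) (f-hom , g-hom) d<a+b f+g≈0 =
      (𝔽ₚ[y][x].mk≋ λ i → 𝔽ₚ[y].mk≋ λ j → proj₁ (vanish i j))
    , (𝔽ₚ[y][x].mk≋ λ i → 𝔽ₚ[y].mk≋ λ j → proj₂ (vanish i j))
    where
    sum≈0 : ∀ i j → coeff f i j ℤ.+ coeff g i j ≈ᶻ 0ℤ
    sum≈0 i j = Z.trans (Z.sym (coeff-+P f g i j)) (coeff-≈ f+g≈0 i j)
    vanish : ∀ i j → coeff f i j ≈ᶻ 0ℤ × coeff g i j ≈ᶻ 0ℤ
    vanish i j with i + j ℕ.≟ d | i ℕ.<? a | j ℕ.<? b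
    ... | no i+j≢d | _ | _ = ℤ-mod.∣⇒≈0 p (f-hom i j i+j≢d) , ℤ-mod.∣⇒≈0 p (g-hom i j i+j≢d)
    ... | yes _ | yes i<a | _ = f≈0 , Z.trans (Z.sym (Z.+-identityˡ _))
                                        (Z.trans (Z.+-cong (Z.sym f≈0) (Z.refl {coeff g i j})) (sum≈0 i j))
      where f≈0 = X^∣⇒coeff≈0 a {f} (divides u (≈[]⇒≈ f≈X^u)) j i<a
    ... | yes _ | no _ | yes j<b = Z.trans (Z.sym (Z.+-identityʳ _))
                                     (Z.trans (Z.+-cong (Z.refl {coeff f i j}) (Z.sym g≈0)) (sum≈0 i j)) , g≈0
      where g≈0 = Y^∣⇒coeff≈0 b {g} (divides v (≈[]⇒≈ g≈Y^v)) i j<b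
    ... | yes ≡.refl | no i≮a | no j≮b =
      contradiction (ℕᵖ.+-mono-≤ (ℕᵖ.≮⇒≥ i≮a) (ℕᵖ.≮⇒≥ j≮b)) (ℕᵖ.<⇒≱ d<a+b)

  η : ℕ → ℕ → ℕ → Der
  η m a b = (X+Y ^P m) *P monomial a b , 0P

  η∈D : ∀ m a b → InD p (a , b , m) (η m a b)
  η∈D m a b = InD-intro (a , b , m) (divides ((X+Y ^P m) *P (Y ^P b)) (x∙yz≈y∙xz (X+Y ^P m) (X ^P a) (Y ^P b)))
                                    (divides 0P (P.sym (P.zeroʳ (Y ^P b))))
                                    (divides (monomial a b) (P.+-identityʳ _))
    where open import Algebra.Properties.CommutativeSemigroup P.*-commutativeSemigroup using (x∙yz≈y∙xz)

  module _ (p-prime : Prime p) where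

    1≉0 : ¬ constP 1ℤ ≈ 0P
    1≉0 1≈0 = ℤ-mod.prime⇒1≉0 p p-prime (coeff-≈ 1≈0 0 0)

    θxy-η≉0 : ∀ m a b → ¬ θxy (η m a b) ≈ 0P
    θxy-η≉0 m a b ηxy≈0 = 1≉0 $ monomial-regular a b $ P.trans (P.*-identityʳ (monomial a b)) $
      ^P-regular X+Y-regular m (P.trans (P.sym (P.+-identityʳ _)) ηxy≈0)

    binomialsVanish : ∀ m a b f g h → X ^P a ∣ᴾ f → Y ^P b ∣ᴾ g → f +P g ≈ (X+Y ^P m) *P h →
                      ¬ coeff h 0 0 ≈ᶻ 0ℤ → BinomialsVanish m a b
    binomialsVanish m a b f g h X^a∣f Y^b∣g f+g≈[X+Y]^mh h₀₀≉0 i j i<a j<b i+j≡m =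
      ℤ-mod.k*x≈0⇒n∣k p p-prime (m C i) h₀₀≉0 $ begin
        + (m C i) ℤ.* coeff h 0 0    ≈⟨ coeff-X+Y^*P-top m h i j i+j≡m ⟨
        coeff ((X+Y ^P m) *P h) i j  ≈⟨ coeff-≈ f+g≈[X+Y]^mh i j ⟨
        coeff (f +P g) i j           ≈⟨ coeff-+P f g i j ⟩
        coeff f i j ℤ.+ coeff g i j  ≈⟨ Z.+-cong (X^∣⇒coeff≈0 a X^a∣f j i<a) (Y^∣⇒coeff≈0 b Y^b∣g i j<b) ⟩
        0ℤ                           ∎
      where open ≈ᶻ-Reasoning

    θxy≈0⊎binomialsVanish : ∀ m a b θ d → InD p (a , b , m) θ → HomogeneousDer p d θ → d ≤ m →
                            θxy θ ≈ 0P ⊎ BinomialsVanish m a b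
    θxy≈0⊎binomialsVanish m a b (f , g) d ((u , f≈X^u) , (v , g≈Y^v) , (h , f+g≈[X+Y]^mh))
                          (f-hom , g-hom) d≤m with ℤ-mod.≈0? p (coeff h 0 0)
    ... | yes h₀₀≈0 = inj₁ (homogeneous-multiple≈0 d m (f +P g) h (+P-homogeneous d f g f-hom g-hom) d≤m
                              (≈[]⇒≈ f+g≈[X+Y]^mh) h₀₀≈0)
    ... | no h₀₀≉0 = inj₂ (binomialsVanish m a b f g h (divides u (≈[]⇒≈ f≈X^u)) (divides v (≈[]⇒≈ g≈Y^v))
                             (≈[]⇒≈ f+g≈[X+Y]^mh) h₀₀≉0)

    spanning-pair⇒θxy≉0 : ∀ m a b θ₁ θ₂ →
      (∀ θ → InD p (a , b , m) θ → ∃₂ λ α β → θ ≈D[ p ] ((α ·D θ₁) +D (β ·D θ₂))) →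
      θxy θ₁ ≈ 0P → θxy θ₂ ≈ 0P → ⊥
    spanning-pair⇒θxy≉0 m a b θ₁ θ₂ spans θ₁xy≈0 θ₂xy≈0 =
      θxy-η≉0 m a b (θxy≈0 (η m a b) (spans (η m a b) (η∈D m a b)))
      where
      θxy≈0 : ∀ θ → (∃₂ λ α β → θ ≈D[ p ] ((α ·D θ₁) +D (β ·D θ₂))) → θxy θ ≈ 0P
      θxy≈0 θ (α , β , θ≈) = begin
        θxy θ                         ≈⟨ θxy-cong θ ((α ·D θ₁) +D (β ·D θ₂)) θ≈ ⟩
        θxy ((α ·D θ₁) +D (β ·D θ₂))  ≈⟨ θxy-linear α θ₁ β θ₂ ⟩
        α *P θxy θ₁ +P β *P θxy θ₂    ≈⟨ P.+-cong (*P-congˡ α θ₁xy≈0) (*P-congˡ β θ₂xy≈0) ⟩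
        α *P 0P +P β *P 0P            ≈⟨ P.+-cong (P.zeroʳ α) (P.zeroʳ β) ⟩
        0P +P 0P                      ≈⟨ P.+-identityʳ 0P ⟩
        0P                            ∎
        where open ≈-Reasoning

    independent-pair⇒θ₁≉0 : ∀ θ₁ θ₂ →
      (∀ α β → ((α ·D θ₁) +D (β ·D θ₂)) ≈D[ p ] 0D → (α ≈[ p ] 0P) × (β ≈[ p ] 0P)) →
      θx θ₁ ≈ 0P → θy θ₁ ≈ 0P → ⊥
    independent-pair⇒θ₁≉0 θ₁ θ₂ independent θ₁x≈0 θ₁y≈0 =
      1≉0 (≈[]⇒≈ (proj₁ (independent (constP 1ℤ) 0P
                           (≈⇒≈[] (only-θ₁ (θx θ₂) θ₁x≈0) , ≈⇒≈[] (only-θ₁ (θy θ₂) θ₁y≈0)))))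
      where
      only-θ₁ : ∀ {f₁} f₂ → f₁ ≈ 0P → constP 1ℤ *P f₁ +P 0P *P f₂ ≈ 0P
      only-θ₁ {f₁} f₂ f₁≈0 =
        P.trans (P.+-cong (P.*-identityˡ f₁) (P.zeroˡ f₂)) (P.trans (P.+-identityʳ f₁) f₁≈0)

    exp⇒binomialsVanish : ∀ m a b → ExpIs p (a , b , m) m (a + b) → BinomialsVanish m a b
    exp⇒binomialsVanish m a b (θ₁ , θ₂ , (θ₁∈D , θ₂∈D , spans , independent) , θ₁-hom , θ₂-hom)
      with θxy≈0⊎binomialsVanish m a b θ₁ m θ₁∈D θ₁-hom ℕᵖ.≤-refl | a + b ℕ.≤? m
    ... | inj₂ vanish | _ = vanish
    ... | inj₁ θ₁xy≈0 | no a+b≰m =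
      ⊥-elim (independent-pair⇒θ₁≉0 θ₁ θ₂ independent (proj₁ θ₁≈0) (proj₂ θ₁≈0))
      where θ₁≈0 = low-degree-θxy≈0⇒θ≈0 (a , b , m) θ₁ m θ₁∈D θ₁-hom (ℕᵖ.≰⇒> a+b≰m) θ₁xy≈0
    ... | inj₁ θ₁xy≈0 | yes a+b≤m
      with θxy≈0⊎binomialsVanish m a b θ₂ (a + b) θ₂∈D θ₂-hom a+b≤m
    ...   | inj₂ vanish = vanish
    ...   | inj₁ θ₂xy≈0 = ⊥-elim (spanning-pair⇒θxy≉0 m a b θ₁ θ₂ spans θ₁xy≈0 θ₂xy≈0)

open import Data.Nat using (_<_; _+_)
open import Defs using (Mult; InΓ; InΛ; ExpIs; μ₁; μ₂)
open import Function.Bundles using (_⇔_; mk⇔)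

theorem5p6 : (p : ℕ) → Prime p → (m : ℕ) → 0 < m → (μ : Mult) →
    InΓ p m μ ⇔ (InΛ m μ × ExpIs p μ m (μ₁ μ + μ₂ μ))
theorem5p6 p p-prime m _ (a , b , _) = mk⇔
  (λ { (≡.refl , basis) → ≡.refl , Ψ.ψ-basis⇒exp m a b basis })
  (λ { (≡.refl , exp) → ≡.refl , Ψ.binomialsVanish⇒ψ-basis m a b (exp⇒binomialsVanish p-prime m a b exp) })
  where open Arrangement p
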